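{- For all integers $n \geq 3$ and $k \geq 0$, \[ \mathscr{I}(C_n) \cong \begin{cases} K_3 & \text{if } n = 3,\\ 3K_1 & \text{if } n = 3k \geq 6,\\ \mathfrak{B}_k & \text{if } n = 3k+1,\\ C_n & \text{if } n \equiv 2 \pmod 3. \end{cases} \]
   Context: For a graph $G$, $i(G)$ is the minimum size of an independent dominating set, and an $i$-set of $G$ is an independent dominating set of size $i(G)$. The $i$-graph $\mathscr{I}(G)$ has the $i$-sets of $G$ as vertices, with $X,Y$ adjacent if and only if there is an edge $xy\in E(G)$ with $x\in X$, $y \notin X$ and $Y=(X\setminus\{x\})\cup\{y\}$. $C_n$ is the cycle on $n$ vertices and $3K_1$ is the edgeless graph on $3$ vertices. For $k \ge 1$, the bracelet graph $\mathfrak{B}_k$ is defined as follows, with all arithmetic modulo $3k+1$: its vertex set consists of all distinct $2$-subsets $\{j,\ell\}$ of $\{0,1,\dots,3k\}$ such that $\ell \equiv j+3s+2 \pmod{3k+1}$ for some $s \in \{0,1,\dots,k-1\}$; two vertices are adjacent if and only if they share one element and their other elements differ by $3$ modulo $3k+1$, i.e. the neighbours of $\{j,\ell\}$ are those of the pairs $\{j,\ell+3\},\{j,\ell-3\},\{j+3,\ell\},\{j-3,\ell\}$ that are vertices of $\mathfrak{B}_k$. (Equivalently, for $k \ge 2$: if $\ell - j \equiv 2$, the neighbours of $\{j,\ell\}$ are exactly $\{j,\ell+3\}$ and $\{j-3,\ell\}$; if $j-\ell\not\equiv \pm 2$, the neighbours are all four of the listed pairs.) -}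

module Defs where

open import Data.Nat using (ℕ; zero; suc; _+_; _*_; _≤_; _<_; _%_)
open import Data.Fin using (Fin; toℕ)
open import Data.Fin.Subset using (Subset; _∈_; _∉_; _∪_; _-_; ⁅_⁆; ∣_∣)
open import Data.Product using (Σ; ∃; ∃-syntax; _×_; _,_)
open import Data.Sum using (_⊎_)
open import Data.Empty using (⊥)
open import Relation.Nullary using (¬_)
open import Relation.Binary.PropositionalEquality using (_≡_; _≢_)

record Graph : Set₁ where
  field
    V   : Set
    Adj : V → V → Set

open Graph public

record _≅_ (G H : Graph) : Set where
  field
    to       : V G → V H
    from     : V H → V G
    from∘to  : ∀ v → from (to v) ≡ v
    to∘from  : ∀ w → to (from w) ≡ w
    adj-to   : ∀ u v → Adj G u v → Adj H (to u) (to v)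
    adj-from : ∀ u v → Adj H (to u) (to v) → Adj G u v

record FinGraph : Set₁ where
  field
    order : ℕ
    E     : Fin order → Fin order → Set

open FinGraph public

asGraph : FinGraph → Graph
asGraph G = record { V = Fin (order G) ; Adj = E G }

module _ (G : FinGraph) where

  Independent : Subset (order G) → Set
  Independent X = ∀ x y → x ∈ X → y ∈ X → ¬ E G x y

  Dominating : Subset (order G) → Set
  Dominating X = ∀ v → v ∈ X ⊎ (∃[ u ] (u ∈ X × E G u v))

  IndepDom : Subset (order G) → Set
  IndepDom X = Independent X × Dominating X

  IsISet : Subset (order G) → Set
  IsISet X = IndepDom X × (∀ Y → IndepDom Y → ∣ X ∣ ≤ ∣ Y ∣)

  -- vertices of the i-graph (the proof of being an i-set is irrelevant,
  -- so two i-graph vertices are equal iff their underlying sets are)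
  record ISet : Set where
    constructor iset
    field
      set    : Subset (order G)
      .isISet : IsISet set

  open ISet

  IAdj : ISet → ISet → Set
  IAdj X Y = ∃[ x ] ∃[ y ] (E G x y × x ∈ set X × y ∉ set X
                           × set Y ≡ (set X - x) ∪ ⁅ y ⁆)

  iGraph : Graph
  iGraph = record { V = ISet ; Adj = IAdj }

CycleE : (n : ℕ) → Fin n → Fin n → Set
CycleE n i j = suc (toℕ i) ≡ toℕ j ⊎ suc (toℕ j) ≡ toℕ i
             ⊎ (suc (toℕ i) ≡ n × toℕ j ≡ 0) ⊎ (suc (toℕ j) ≡ n × toℕ i ≡ 0)

Cycle : ℕ → FinGraph
Cycle n = record { order = n ; E = CycleE n }

K3 : Graph
K3 = record { V = Fin 3 ; Adj = λ i j → i ≢ j }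

threeK1 : Graph
threeK1 = record { V = Fin 3 ; Adj = λ _ _ → ⊥ }

-- a 2-subset {j,ℓ} is stored canonically with j < ℓ
record BVertex (k : ℕ) : Set where
  constructor bv
  field
    lo hi : ℕ
    .lo<hi  : lo < hi
    .hi<mod : hi < suc (3 * k)
    .cond   : ∃[ s ] (s < k × (lo + 3 * s + 2) % suc (3 * k) ≡ hi
                            ⊎ s < k × (hi + 3 * s + 2) % suc (3 * k) ≡ lo)

open BVertex

IsPair : ∀ {k} → BVertex k → ℕ → ℕ → Set
IsPair u x y = (lo u ≡ x × hi u ≡ y) ⊎ (lo u ≡ y × hi u ≡ x)

BAdj : (k : ℕ) → BVertex k → BVertex k → Set
BAdj k u v = ∃[ x ] ∃[ y ] ∃[ z ] (IsPair u x y × IsPair v x z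
              × ((y + 3) % suc (3 * k) ≡ z ⊎ (z + 3) % suc (3 * k) ≡ y))

Bracelet : ℕ → Graph
Bracelet k = record { V = BVertex k ; Adj = BAdj k }

module Submission where

-- Write χ X for the N-periodic indicator of X ⊆ C_N and weight X v for |X ∩ {v, v+1, v+2}|.
-- Summing over v gives Σ weight = 3|X|, and for independent dominating X every weight is 1 or 2,
-- so i(C_N) = ⌈N/3⌉ and an i-set has exactly 3⌈N/3⌉ − N windows of weight 2.  Such a window
-- surrounds a centre: a vertex c ∉ X with c ± 1 ∈ X.  Away from the centres X repeats 1 0 0, so an
-- i-set is determined by its centres: there are none for N = 3k (three i-sets), one anywhere for
-- N = 3k+2, and two at distance ≡ 2 (mod 3) for N = 3k+1.  Sliding a token moves one centre by ±3
-- and keeps the others.  Hence C_3k (k ≥ 2) admits no slides; for N = 3k+2 the map c ↦ c/3 (mod N)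
-- turns the moves ±3 into ±1, giving C_N again; for N = 3k+1 the pair of centres is a vertex of
-- the bracelet graph and slides are its edges.

open import Defs
open import Data.Nat using (ℕ; zero; suc; _+_; _*_; _∸_; _≤_; _<_; _%_; _/_; z≤n; s≤s; _≡ᵇ_; NonZero; _<?_)
open import Data.Nat.Properties
open import Data.Nat.DivMod
open import Data.Nat.Tactic.RingSolver using (solve-∀)
open import Data.Bool using (Bool; true; false; T; _∧_; _∨_; not; if_then_else_)
import Data.Bool
import Data.Bool.Properties
open import Data.Unit using (tt)
open import Data.Fin using (Fin; toℕ) renaming (zero to fz; suc to fs)
open import Data.Fin.Properties using (toℕ-injective; toℕ<n; toℕ-fromℕ<)
open import Data.Fin.Subset using (Subset; _∈_; _∉_; _∪_; _─_; _-_; ⁅_⁆; ∣_∣)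
open import Data.Vec using (Vec; []; _∷_; lookup; tabulate)
open import Data.Vec.Properties using ([]=⇒lookup; lookup⇒[]=; tabulate∘lookup; tabulate-cong)
import Data.Vec.Properties
open import Data.Product using (Σ; ∃-syntax; _×_; _,_; proj₁; proj₂)
open import Data.Sum using (_⊎_; inj₁; inj₂)
open import Data.Empty using (⊥; ⊥-elim; ⊥-elim-irr)
open import Relation.Binary using (tri<; tri≈; tri>)
open import Relation.Binary.PropositionalEquality
open import Relation.Nullary using (¬_; ¬?; yes; no; Dec; _⊎-dec_; _×-dec_)
open import Relation.Nullary.Decidable using (recompute; toWitness)
open import Algebra.Properties.CommutativeSemigroup +-commutativeSemigroup using (interchange)

bit : Bool → ℕ
bit true = 1
bit false = 0

bit-injective : ∀ a b → bit a ≡ bit b → a ≡ b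
bit-injective true true e = refl
bit-injective false false e = refl
bit-injective true false ()
bit-injective false true ()

true≢false : true ≢ false
true≢false ()

x≡true⇒x≢false : ∀ {a} → a ≡ true → a ≡ false → ⊥
x≡true⇒x≢false refl ()

≢true⇒false : ∀ {a} → (a ≡ true → ⊥) → a ≡ false
≢true⇒false {true} f = ⊥-elim (f refl)
≢true⇒false {false} f = refl

≡ᵇ-refl : ∀ a → (a ≡ᵇ a) ≡ true
≡ᵇ-refl zero = refl
≡ᵇ-refl (suc a) = ≡ᵇ-refl a

≡⇒≡ᵇtrue : ∀ {a b} → a ≡ b → (a ≡ᵇ b) ≡ true
≡⇒≡ᵇtrue {a} refl = ≡ᵇ-refl a

≢⇒≡ᵇfalse : ∀ {a b} → a ≢ b → (a ≡ᵇ b) ≡ false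
≢⇒≡ᵇfalse {zero} {zero} ne = ⊥-elim (ne refl)
≢⇒≡ᵇfalse {zero} {suc b} ne = refl
≢⇒≡ᵇfalse {suc a} {zero} ne = refl
≢⇒≡ᵇfalse {suc a} {suc b} ne = ≢⇒≡ᵇfalse {a} {b} (λ e → ne (cong suc e))

∨₃-true : ∀ a b c → (a ∨ b ∨ c) ≡ true → a ≡ true ⊎ b ≡ true ⊎ c ≡ true
∨₃-true true b c e = inj₁ refl
∨₃-true false true c e = inj₂ (inj₁ refl)
∨₃-true false false true e = inj₂ (inj₂ refl)

∨₃-intro₁ : ∀ {a} b c → a ≡ true → (a ∨ b ∨ c) ≡ true
∨₃-intro₁ b c refl = refl

∨₃-intro₂ : ∀ a {b} c → b ≡ true → (a ∨ b ∨ c) ≡ true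
∨₃-intro₂ true c e = refl
∨₃-intro₂ false c refl = refl

∨₃-intro₃ : ∀ a b {c} → c ≡ true → (a ∨ b ∨ c) ≡ true
∨₃-intro₃ true b e = refl
∨₃-intro₃ false true e = refl
∨₃-intro₃ false false refl = refl

∨₃-first : ∀ {a b c} → (a ∨ b ∨ c) ≡ true → b ≡ false → c ≡ false → a ≡ true
∨₃-first {true} e _ _ = refl
∨₃-first {false} {false} {false} () _ _
∨₃-first {false} {true} e () _
∨₃-first {false} {false} {true} e _ ()

∨₃-third : ∀ {a b c} → (a ∨ b ∨ c) ≡ true → a ≡ false → b ≡ false → c ≡ true
∨₃-third {false} {false} {true} e _ _ = refl
∨₃-third {false} {false} {false} () _ _
∨₃-third {true} e () _
∨₃-third {false} {true} e _ ()

∨₃-mono : ∀ {a b c a' b' c'} → (a ≡ true → a' ≡ true) → (b ≡ true → b' ≡ true) → (c ≡ true → c' ≡ true) →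
           (a ∨ b ∨ c) ≡ true → (a' ∨ b' ∨ c') ≡ true
∨₃-mono {true} f g h e rewrite f refl = refl
∨₃-mono {false} {true} {_} {a'} f g h e rewrite g refl = Data.Bool.Properties.∨-zeroʳ a'
∨₃-mono {false} {false} {true} {a'} {b'} f g h e rewrite h refl | Data.Bool.Properties.∨-zeroʳ b' = Data.Bool.Properties.∨-zeroʳ a'

m+1+n≰m+n : ∀ a b → a + suc b ≤ a + b → ⊥
m+1+n≰m+n a b h = <-irrefl refl (+-cancelˡ-≤ a (suc b) b h)

window-cancel : ∀ a b c d → (a + b) + c ≡ (b + c) + d → a ≡ d
window-cancel a b c d e = +-cancelˡ-≡ (b + c) a d (trans (+-comm (b + c) a) (trans (sym (+-assoc a b c)) e))

Σ< : ℕ → (ℕ → ℕ) → ℕ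
Σ< zero f = 0
Σ< (suc n) f = f 0 + Σ< n (λ v → f (suc v))

Σ-cong : ∀ n {f g : ℕ → ℕ} → (∀ v → v < n → f v ≡ g v) → Σ< n f ≡ Σ< n g
Σ-cong zero h = refl
Σ-cong (suc n) h = cong₂ _+_ (h 0 (s≤s z≤n)) (Σ-cong n (λ v p → h (suc v) (s≤s p)))

Σ-mono : ∀ n {f g : ℕ → ℕ} → (∀ v → v < n → f v ≤ g v) → Σ< n f ≤ Σ< n g
Σ-mono zero h = z≤n
Σ-mono (suc n) h = +-mono-≤ (h 0 (s≤s z≤n)) (Σ-mono n (λ v p → h (suc v) (s≤s p)))

Σ-+ : ∀ n (f g : ℕ → ℕ) → Σ< n (λ v → f v + g v) ≡ Σ< n f + Σ< n g
Σ-+ zero f g = refl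
Σ-+ (suc n) f g rewrite Σ-+ n (λ v → f (suc v)) (λ v → g (suc v)) = interchange (f 0) (g 0) _ _

Σ-const : ∀ n c → Σ< n (λ _ → c) ≡ n * c
Σ-const zero c = refl
Σ-const (suc n) c = cong (c +_) (Σ-const n c)

Σ-ones : ∀ n → Σ< n (λ _ → 1) ≡ n
Σ-ones n = trans (Σ-const n 1) (*-identityʳ n)

Σ-last : ∀ n f → Σ< (suc n) f ≡ Σ< n f + f n
Σ-last zero f = +-comm (f 0) 0
Σ-last (suc n) f rewrite Σ-last n (λ v → f (suc v)) = sym (+-assoc (f 0) _ _)

Σ-shift : ∀ n f → f n ≡ f 0 → Σ< n (λ v → f (suc v)) ≡ Σ< n f
Σ-shift n f p = +-cancelˡ-≡ (f 0) _ _ (trans (Σ-last n f) (trans (cong (Σ< n f +_) p) (+-comm (Σ< n f) (f 0))))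

indicator : ℕ → ℕ → ℕ
indicator x v = bit (v ≡ᵇ x)

indicator-self : ∀ x → indicator x x ≡ 1
indicator-self zero = refl
indicator-self (suc x) = indicator-self x

indicator-other : ∀ x v → v ≢ x → indicator x v ≡ 0
indicator-other zero zero ne = ⊥-elim (ne refl)
indicator-other zero (suc v) ne = refl
indicator-other (suc x) zero ne = refl
indicator-other (suc x) (suc v) ne = indicator-other x v (λ e → ne (cong suc e))

indicator-cases : ∀ x v → v ≡ x ⊎ (v ≢ x × indicator x v ≡ 0)
indicator-cases x v with v ≟ x
... | yes e = inj₁ e
... | no ne = inj₂ (ne , indicator-other x v ne)

Σ-indicator : ∀ n x → x < n → Σ< n (indicator x) ≡ 1
Σ-indicator (suc n) zero p = cong suc (Σ-zero n)
  where
  Σ-zero : ∀ m → Σ< m (λ v → indicator 0 (suc v)) ≡ 0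
  Σ-zero zero = refl
  Σ-zero (suc m) = Σ-zero m
Σ-indicator (suc n) (suc x) (s≤s p) = Σ-indicator n x p

Σ-+indicator : ∀ n f d → d < n → Σ< n (λ v → f v + indicator d v) ≡ Σ< n f + 1
Σ-+indicator n f d p = trans (Σ-+ n f (indicator d)) (cong (Σ< n f +_) (Σ-indicator n d p))

Σ-1+indicator : ∀ n d → d < n → Σ< n (λ v → 1 + indicator d v) ≡ n + 1
Σ-1+indicator n d p = trans (Σ-+indicator n (λ _ → 1) d p) (cong (_+ 1) (Σ-ones n))

Σ-excess₁ : ∀ n f d → d < n → (∀ v → v < n → 1 ≤ f v) → 2 ≤ f d → n + 1 ≤ Σ< n f
Σ-excess₁ n f d dN h hd = subst (_≤ Σ< n f) (Σ-1+indicator n d dN) (Σ-mono n pw)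
  where
  pw : ∀ v → v < n → 1 + indicator d v ≤ f v
  pw v p with indicator-cases d v
  ... | inj₁ refl = subst (λ t → 1 + t ≤ f v) (sym (indicator-self v)) hd
  ... | inj₂ (_ , z) rewrite z = h v p

Σ-excess₂ : ∀ n f d1 d2 → d1 < n → d2 < n → d1 ≢ d2 → (∀ v → v < n → 1 ≤ f v) → 2 ≤ f d1 → 2 ≤ f d2 → n + 2 ≤ Σ< n f
Σ-excess₂ n f d1 d2 p1 p2 ne h h1 h2 = subst (_≤ Σ< n f) total (Σ-mono n pw)
  where
  total : Σ< n (λ v → (1 + indicator d1 v) + indicator d2 v) ≡ n + 2
  total = trans (Σ-+indicator n _ d2 p2) (trans (cong (_+ 1) (Σ-1+indicator n d1 p1)) (+-assoc n 1 1))
  pw : ∀ v → v < n → (1 + indicator d1 v) + indicator d2 v ≤ f v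
  pw v p with indicator-cases d1 v | indicator-cases d2 v
  ... | inj₁ refl | inj₁ refl = ⊥-elim (ne refl)
  ... | inj₁ refl | inj₂ (_ , z) rewrite z | indicator-self v = h1
  ... | inj₂ (_ , z) | inj₁ refl rewrite z | indicator-self v = h2
  ... | inj₂ (_ , z) | inj₂ (_ , z') rewrite z | z' = h v p

Σ-excess₃ : ∀ n f d1 d2 d3 → d1 < n → d2 < n → d3 < n → d1 ≢ d2 → d1 ≢ d3 → d2 ≢ d3 →
            (∀ v → v < n → 1 ≤ f v) → 2 ≤ f d1 → 2 ≤ f d2 → 2 ≤ f d3 → n + 3 ≤ Σ< n f
Σ-excess₃ n f d1 d2 d3 p1 p2 p3 n12 n13 n23 h h1 h2 h3 = subst (_≤ Σ< n f) total (Σ-mono n pw)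
  where
  total : Σ< n (λ v → ((1 + indicator d1 v) + indicator d2 v) + indicator d3 v) ≡ n + 3
  total = trans (Σ-+indicator n _ d3 p3) (trans (cong (_+ 1) (trans (Σ-+indicator n _ d2 p2)
            (trans (cong (_+ 1) (Σ-1+indicator n d1 p1)) (+-assoc n 1 1)))) (+-assoc n 2 1))
  pw : ∀ v → v < n → ((1 + indicator d1 v) + indicator d2 v) + indicator d3 v ≤ f v
  pw v p with indicator-cases d1 v | indicator-cases d2 v | indicator-cases d3 v
  ... | inj₁ refl | inj₁ refl | _ = ⊥-elim (n12 refl)
  ... | inj₁ refl | _ | inj₁ refl = ⊥-elim (n13 refl)
  ... | _ | inj₁ refl | inj₁ refl = ⊥-elim (n23 refl)
  ... | inj₁ refl | inj₂ (_ , z) | inj₂ (_ , z') rewrite z | z' | indicator-self v = h1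
  ... | inj₂ (_ , z) | inj₁ refl | inj₂ (_ , z') rewrite z | z' | indicator-self v = h2
  ... | inj₂ (_ , z) | inj₂ (_ , z') | inj₁ refl rewrite z | z' | indicator-self v = h3
  ... | inj₂ (_ , z) | inj₂ (_ , z') | inj₂ (_ , z'') rewrite z | z' | z'' = h v p

Σ-≤1 : ∀ n f → (∀ v → v < n → f v ≤ 1) → Σ< n f ≤ n
Σ-≤1 n f h = subst (Σ< n f ≤_) (Σ-ones n) (Σ-mono n h)

Σ-≤1+indicator : ∀ n f d → d < n → (∀ v → v < n → f v ≤ 1 + indicator d v) → Σ< n f ≤ n + 1
Σ-≤1+indicator n f d p h = subst (Σ< n f ≤_) (Σ-1+indicator n d p) (Σ-mono n h)

search< : (P : ℕ → Bool) → ∀ L → (Σ ℕ λ j → j < L × P j ≡ true) ⊎ (∀ j → j < L → P j ≡ false)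
search< P zero = inj₂ (λ j ())
search< P (suc L) with search< P L | P L in e
... | inj₁ (j , p , q) | _ = inj₁ (j , ≤-trans p (n≤1+n L) , q)
... | inj₂ h | true = inj₁ (L , ≤-refl , e)
... | inj₂ h | false = inj₂ λ j p → case≤ j p h e
  where
  case≤ : ∀ j → j < suc L → (∀ j → j < L → P j ≡ false) → P L ≡ false → P j ≡ false
  case≤ j p h e with m≤n⇒m<n∨m≡n (≤-pred p)
  ... | inj₁ lt = h j lt
  ... | inj₂ refl = e

first : (ℕ → Bool) → ℕ → ℕ → ℕ
first P s zero = s
first P s (suc f) = if P s then s else first P (suc s) f

first-spec : ∀ P f s j → s ≤ j → j < s + f → P j ≡ true →
            s ≤ first P s f × first P s f ≤ j × P (first P s f) ≡ true
first-spec P zero s j p q r = ⊥-elim (<-irrefl refl (≤-trans q (≤-trans (≤-reflexive (+-identityʳ s)) p)))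
first-spec P (suc f) s j p q r with P s in e
... | true = ≤-refl , p , e
... | false with m≤n⇒m<n∨m≡n p
...   | inj₂ refl = ⊥-elim (x≡true⇒x≢false r e)
...   | inj₁ lt with first-spec P f (suc s) j lt (subst (j <_) (+-suc s f) q) r
...     | a , b , c = ≤-trans (n≤1+n s) a , b , c

lookupℕ : ∀ {n} → Vec Bool n → ℕ → Bool
lookupℕ [] v = false
lookupℕ (x ∷ xs) zero = x
lookupℕ (x ∷ xs) (suc v) = lookupℕ xs v

lookupℕ-toℕ : ∀ {n} (X : Vec Bool n) (i : Fin n) → lookupℕ X (toℕ i) ≡ lookup X i
lookupℕ-toℕ (x ∷ X) fz = refl
lookupℕ-toℕ (x ∷ X) (fs i) = lookupℕ-toℕ X i

∣∣≡Σ-lookupℕ : ∀ {n} (X : Vec Bool n) → ∣ X ∣ ≡ Σ< n (λ v → bit (lookupℕ X v))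
∣∣≡Σ-lookupℕ [] = refl
∣∣≡Σ-lookupℕ (true ∷ X) = cong suc (∣∣≡Σ-lookupℕ X)
∣∣≡Σ-lookupℕ (false ∷ X) = ∣∣≡Σ-lookupℕ X

lookupℕ-ext : ∀ {n} (X Y : Vec Bool n) → (∀ v → v < n → lookupℕ X v ≡ lookupℕ Y v) → X ≡ Y
lookupℕ-ext {n} X Y h = trans (sym (tabulate∘lookup X)) (trans (tabulate-cong (λ i → trans (sym (lookupℕ-toℕ X i)) (trans (h
    (toℕ i) (toℕ<n i)) (lookupℕ-toℕ Y i)))) (tabulate∘lookup Y))

lookupℕ-tabulate : ∀ {n} (g : ℕ → Bool) v → v < n → lookupℕ (tabulate {n = n} (λ i → g (toℕ i))) v ≡ g v
lookupℕ-tabulate {suc n} g zero p = refl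
lookupℕ-tabulate {suc n} g (suc v) (s≤s p) = lookupℕ-tabulate (λ u → g (suc u)) v p

∈⇒lookupℕ : ∀ {n} {X : Vec Bool n} {i : Fin n} → i ∈ X → lookupℕ X (toℕ i) ≡ true
∈⇒lookupℕ {X = X} {i} m = trans (lookupℕ-toℕ X i) ([]=⇒lookup m)

lookupℕ⇒∈ : ∀ {n} {X : Vec Bool n} {i : Fin n} → lookupℕ X (toℕ i) ≡ true → i ∈ X
lookupℕ⇒∈ {X = X} {i} e = lookup⇒[]= i X (trans (sym (lookupℕ-toℕ X i)) e)

lookupℕ-⁅⁆ : ∀ {n} (y : Fin n) v → lookupℕ ⁅ y ⁆ v ≡ (v ≡ᵇ toℕ y)
lookupℕ-⁅⁆ {suc n} fz zero = refl
lookupℕ-⁅⁆ {suc n} fz (suc v) = lookupℕ-∅ n v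
  where
  lookupℕ-∅ : ∀ m u → lookupℕ (Data.Fin.Subset.⊥ {m}) u ≡ false
  lookupℕ-∅ zero u = refl
  lookupℕ-∅ (suc m) zero = refl
  lookupℕ-∅ (suc m) (suc u) = lookupℕ-∅ m u
lookupℕ-⁅⁆ {suc n} (fs y) zero = refl
lookupℕ-⁅⁆ {suc n} (fs y) (suc v) = lookupℕ-⁅⁆ y v

lookupℕ-─ : ∀ {n} (A S : Vec Bool n) u → lookupℕ (A ─ S) u ≡ (lookupℕ A u ∧ not (lookupℕ S u))
lookupℕ-─ [] [] u = refl
lookupℕ-─ (a ∷ A) (true ∷ S) zero = sym (Data.Bool.Properties.∧-zeroʳ a)
lookupℕ-─ (a ∷ A) (false ∷ S) zero = sym (Data.Bool.Properties.∧-identityʳ a)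
lookupℕ-─ (a ∷ A) (s ∷ S) (suc u) = lookupℕ-─ A S u

lookupℕ-remove : ∀ {n} (X : Vec Bool n) (x : Fin n) v → lookupℕ (X - x) v ≡ (lookupℕ X v ∧ not (v ≡ᵇ toℕ x))
lookupℕ-remove X x v = trans (lookupℕ-─ X ⁅ x ⁆ v) (cong (λ t → lookupℕ X v ∧ not t) (lookupℕ-⁅⁆ x v))

lookupℕ-∪ : ∀ {n} (A S : Vec Bool n) v → lookupℕ (A ∪ S) v ≡ (lookupℕ A v ∨ lookupℕ S v)
lookupℕ-∪ [] [] v = refl
lookupℕ-∪ (a ∷ A) (s ∷ S) zero = refl
lookupℕ-∪ (a ∷ A) (s ∷ S) (suc v) = lookupℕ-∪ A S v

thrice : ℕ → ℕ
thrice zero = zero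
thrice (suc s) = suc (suc (suc (thrice s)))

thrice≡3* : ∀ s → thrice s ≡ 3 * s
thrice≡3* zero = refl
thrice≡3* (suc s) = trans (cong (3 +_) (thrice≡3* s)) (sym (*-suc 3 s))

thrice-+ : ∀ a b → thrice (a + b) ≡ thrice a + thrice b
thrice-+ zero b = refl
thrice-+ (suc a) b = cong (λ z → suc (suc (suc z))) (thrice-+ a b)

⌈/3⌉ : ℕ → ℕ
⌈/3⌉ zero = zero
⌈/3⌉ (suc zero) = 1
⌈/3⌉ (suc (suc zero)) = 1
⌈/3⌉ (suc (suc (suc L))) = suc (⌈/3⌉ L)

⌈/3⌉-thrice+ : ∀ t r → ⌈/3⌉ (thrice t + r) ≡ t + ⌈/3⌉ r
⌈/3⌉-thrice+ zero r = refl
⌈/3⌉-thrice+ (suc t) r = cong suc (⌈/3⌉-thrice+ t r)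

3⌈/3⌉≤+2 : ∀ L → 3 * ⌈/3⌉ L ≤ L + 2
3⌈/3⌉≤+2 zero = z≤n
3⌈/3⌉≤+2 (suc zero) = s≤s (s≤s (s≤s z≤n))
3⌈/3⌉≤+2 (suc (suc zero)) = s≤s (s≤s (s≤s z≤n))
3⌈/3⌉≤+2 (suc (suc (suc L))) = subst (_≤ suc (suc (suc L)) + 2) (sym (*-suc 3 (⌈/3⌉ L))) (s≤s (s≤s (s≤s (3⌈/3⌉≤+2 L))))

⌈/3⌉-least : ∀ L y → L ≤ 3 * y → ⌈/3⌉ L ≤ y
⌈/3⌉-least L y h = ≤-pred (*-cancelˡ-< 3 (⌈/3⌉ L) (suc y) (≤-<-trans (≤-trans (3⌈/3⌉≤+2 L) (+-monoˡ-≤ 2 h)) lem))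
  where
  lem : 3 * y + 2 < 3 * suc y
  lem = ≤-reflexive (trans (cong suc (+-comm (3 * y) 2)) (sym (*-suc 3 y)))

every3rd : ℕ → Bool
every3rd zero = true
every3rd (suc zero) = false
every3rd (suc (suc zero)) = false
every3rd (suc (suc (suc o))) = every3rd o

every3rd-thrice+ : ∀ s r → every3rd (thrice s + r) ≡ every3rd r
every3rd-thrice+ zero r = refl
every3rd-thrice+ (suc s) r = every3rd-thrice+ s r

every3rd⇒thrice : ∀ x → every3rd x ≡ true → Σ ℕ (λ s → x ≡ thrice s)
every3rd⇒thrice zero e = zero , refl
every3rd⇒thrice (suc zero) ()
every3rd⇒thrice (suc (suc zero)) ()
every3rd⇒thrice (suc (suc (suc x))) e with every3rd⇒thrice x e
... | s , eq = suc s , cong (λ t → suc (suc (suc t))) eq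

every3rd-independent : ∀ o → every3rd o ≡ true → every3rd (suc o) ≡ true → ⊥
every3rd-independent zero e1 ()
every3rd-independent (suc zero) () e2
every3rd-independent (suc (suc zero)) () e2
every3rd-independent (suc (suc (suc o))) e1 e2 = every3rd-independent o e1 e2

every3rd-dominating : ∀ o → (every3rd o ∨ every3rd (suc o) ∨ every3rd (suc (suc o))) ≡ true
every3rd-dominating zero = refl
every3rd-dominating (suc zero) = refl
every3rd-dominating (suc (suc zero)) = refl
every3rd-dominating (suc (suc (suc o))) = every3rd-dominating o

Σ-every3rd : ∀ L → Σ< L (λ v → bit (every3rd v)) ≡ ⌈/3⌉ L
Σ-every3rd zero = refl
Σ-every3rd (suc zero) = refl
Σ-every3rd (suc (suc zero)) = refl
Σ-every3rd (suc (suc (suc L))) = cong suc (Σ-every3rd L)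

every3rd-at-3t-2 : ∀ n t → suc (suc (suc (suc n))) ≡ thrice t + 2 → every3rd n ≡ false
every3rd-at-3t-2 n zero ()
every3rd-at-3t-2 n (suc t) e = trans (cong every3rd (suc-injective (trans (suc-injective (suc-injective (suc-injective e))) (+-suc
    (thrice t) 1)))) (every3rd-thrice+ t 1)

every3rd-at-3k-1 : ∀ n k → suc (suc (suc n)) ≡ thrice k → every3rd (suc (suc n)) ≡ false
every3rd-at-3k-1 n zero ()
every3rd-at-3k-1 n (suc k) e = trans (cong every3rd (trans (cong (λ z → suc (suc z)) (suc-injective (suc-injective
    (suc-injective e)))) (+-comm 2 (thrice k)))) (every3rd-thrice+ k 2)

splice : ℕ → (ℕ → Bool) → (ℕ → Bool) → ℕ → Bool
splice zero f g o = g o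
splice (suc A) f g zero = f 0
splice (suc A) f g (suc o) = splice A (λ v → f (suc v)) g o

splice-< : ∀ A f g o → o < A → splice A f g o ≡ f o
splice-< (suc A) f g zero p = refl
splice-< (suc A) f g (suc o) (s≤s p) = splice-< A (λ v → f (suc v)) g o p

splice-+ : ∀ A f g o → splice A f g (A + o) ≡ g o
splice-+ zero f g o = refl
splice-+ (suc A) f g o = splice-+ A (λ v → f (suc v)) g o

Σ-splice : ∀ A C f g → Σ< (A + C) (λ v → bit (splice A f g v)) ≡ Σ< A (λ v → bit (f v)) + Σ< C (λ v → bit (g v))
Σ-splice zero C f g = refl
Σ-splice (suc A) C f g = trans (cong (bit (f 0) +_) (Σ-splice A C (λ v → f (suc v)) g)) (sym (+-assoc (bit (f 0)) _ _))


restart : ℕ → ℕ → Bool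
restart s = splice (thrice s + 2) every3rd every3rd

restart-0 : ∀ s → restart s 0 ≡ true
restart-0 zero = refl
restart-0 (suc s) = refl

restart-independent : ∀ s o → restart s o ≡ true → restart s (suc o) ≡ true → ⊥
restart-independent zero zero _ ()
restart-independent zero (suc zero) () _
restart-independent zero (suc (suc o)) = every3rd-independent o
restart-independent (suc s) zero _ ()
restart-independent (suc s) (suc zero) () _
restart-independent (suc s) (suc (suc zero)) () _
restart-independent (suc s) (suc (suc (suc o))) = restart-independent s o

restart-dominating : ∀ s o → (restart s o ∨ restart s (suc o) ∨ restart s (suc (suc o))) ≡ true
restart-dominating zero zero = refl
restart-dominating zero (suc zero) = refl
restart-dominating zero (suc (suc o)) = every3rd-dominating o
restart-dominating (suc s) zero = refl
restart-dominating (suc s) (suc zero) = restart-0 s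
restart-dominating (suc s) (suc (suc zero)) = ∨₃-intro₂ false (restart s 1) (restart-0 s)
restart-dominating (suc s) (suc (suc (suc o))) = restart-dominating s o

module Segment (c : ℕ → Bool) (indc : ∀ o → c o ≡ true → c (suc o) ≡ true → ⊥) (c0 : c 0 ≡ true) where
  weight : ℕ → ℕ
  weight o = bit (c o) + bit (c (suc o)) + bit (c (suc (suc o)))

  c1 : c 1 ≡ false
  c1 with c 1 in eq
  ... | true = ⊥-elim (indc 0 c0 eq)
  ... | false = refl

  weights-follow-every3rd : ∀ L → (∀ o → o < L → weight o ≡ 1) → ∀ o → o < L →
           c o ≡ every3rd o × c (suc o) ≡ every3rd (suc o) × c (suc (suc o)) ≡ every3rd (suc (suc o))
  weights-follow-every3rd L h zero p = c0 , c1 , lem (h 0 p)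
    where
    lem : weight 0 ≡ 1 → c 2 ≡ false
    lem e rewrite c0 | c1 with c 2
    ... | false = refl
    lem () | true
  weights-follow-every3rd L h (suc o) p with weights-follow-every3rd L h o (≤-trans (n≤1+n (suc o)) p)
  ... | e0 , e1 , e2 = e1 , e2 , e3
    where
    eqw : weight o ≡ weight (suc o)
    eqw = trans (h o (≤-trans (n≤1+n (suc o)) p)) (sym (h (suc o) p))
    e3 : c (suc (suc (suc o))) ≡ every3rd (suc (suc (suc o)))
    e3 = trans (sym (bit-injective _ _ (window-cancel (bit (c o)) (bit (c (suc o))) (bit (c (suc (suc o)))) (bit (c (suc (suc
        (suc o))))) eqw))) e0

  segment : ∀ L → (∀ o → o < L → weight o ≡ 1) → ∀ o → o < suc (suc L) → c o ≡ every3rd o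
  segment L h zero p = c0
  segment L h (suc zero) p = c1
  segment L h (suc (suc o)) (s≤s (s≤s p)) = proj₂ (proj₂ (weights-follow-every3rd L h o p))

module OnCycle (n' : ℕ) where

  N : ℕ
  N = suc (suc (suc n'))

  N-1 : ℕ
  N-1 = suc (suc n')

  G : FinGraph
  G = Cycle N

  fin : ℕ → Fin N
  fin v = v mod N

  toℕ-fin : ∀ v → toℕ (fin v) ≡ v % N
  toℕ-fin v = toℕ-fromℕ< (m%n<n v N)

  -- Subsets are handled through their N-periodic indicator on ℕ, so that rotations are additions.
  opaque
    χ : Subset N → ℕ → Bool
    χ X v = lookupℕ X (v % N)

  opaque
    unfolding χ
    χ-periodic : ∀ X v → χ X (v + N) ≡ χ X v
    χ-periodic X v = cong (lookupℕ X) ([m+n]%n≡m%n v N)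

    χ-cong : ∀ X {a b} → a % N ≡ b % N → χ X a ≡ χ X b
    χ-cong X e = cong (lookupℕ X) e

    χ-toℕ : ∀ X (i : Fin N) → χ X (toℕ i) ≡ lookupℕ X (toℕ i)
    χ-toℕ X i = cong (lookupℕ X) (m<n⇒m%n≡m (toℕ<n i))

    lookupℕ-fin : ∀ X v → lookupℕ X (toℕ (fin v)) ≡ χ X v
    lookupℕ-fin X v = cong (lookupℕ X) (toℕ-fin v)

    χ-def : ∀ X v → χ X v ≡ lookupℕ X (v % N)
    χ-def X v = refl

  ∈⇒χ : ∀ {X i} → i ∈ X → χ X (toℕ i) ≡ true
  ∈⇒χ {X} {i} m = trans (χ-toℕ X i) (∈⇒lookupℕ m)

  χ⇒∈ : ∀ {X v} → χ X v ≡ true → fin v ∈ X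
  χ⇒∈ {X} {v} e = lookupℕ⇒∈ (trans (lookupℕ-fin X v) e)

  ∉⇒χ : ∀ {X} {y : Fin N} → y ∉ X → χ X (toℕ y) ≡ false
  ∉⇒χ {X} {y} ym = ≢true⇒false (λ e → ym (lookupℕ⇒∈ (trans (sym (χ-toℕ X y)) e)))

  mod-idem : ∀ v → (v % N) % N ≡ v % N
  mod-idem v = m%n%n≡m%n v N

  mod-suc : ∀ v → suc (v % N) % N ≡ suc v % N
  mod-suc v = trans (%-distribˡ-+ 1 (v % N) N) (trans (cong (λ t → (1 % N + t) % N) (mod-idem v)) (sym (%-distribˡ-+ 1 v N)))

  mod-+ : ∀ a b → (a % N + b) % N ≡ (a + b) % N
  mod-+ a b = trans (%-distribˡ-+ (a % N) b N) (trans (cong (λ t → (t + b % N) % N) (mod-idem a)) (sym (%-distribˡ-+ a b N)))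

  +-mod-cong : ∀ {a b} c → a % N ≡ b % N → (a + c) % N ≡ (b + c) % N
  +-mod-cong {a} {b} c e = trans (sym (mod-+ a c)) (trans (cong (λ t → (t + c) % N) e) (mod-+ b c))

  suc-mod-injective : ∀ {a b} → suc a % N ≡ suc b % N → a % N ≡ b % N
  suc-mod-injective {a} {b} e = trans (sym (lem a)) (trans (+-mod-cong {suc a} {suc b} N-1 e) (lem b))
    where
    lem : ∀ x → (suc x + N-1) % N ≡ x % N
    lem x = trans (cong (_% N) (sym (+-suc x N-1))) ([m+n]%n≡m%n x N)

  3+-mod-injective : ∀ a b → (3 + a) % N ≡ (3 + b) % N → a % N ≡ b % N
  3+-mod-injective a b e = suc-mod-injective {a} {b} (suc-mod-injective {suc a} {suc b} (suc-mod-injective {suc (suc a)} {suc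
      (suc b)} e))

  CycleE⇒ : ∀ {x y : Fin N} → CycleE N x y → suc (toℕ x) % N ≡ toℕ y ⊎ suc (toℕ y) % N ≡ toℕ x
  CycleE⇒ {x} {y} (inj₁ e) = inj₁ (trans (cong (_% N) e) (m<n⇒m%n≡m (toℕ<n y)))
  CycleE⇒ {x} {y} (inj₂ (inj₁ e)) = inj₂ (trans (cong (_% N) e) (m<n⇒m%n≡m (toℕ<n x)))
  CycleE⇒ {x} {y} (inj₂ (inj₂ (inj₁ (e , z)))) = inj₁ (trans (cong (_% N) e) (trans (n%n≡0 N) (sym z)))
  CycleE⇒ {x} {y} (inj₂ (inj₂ (inj₂ (e , z)))) = inj₂ (trans (cong (_% N) e) (trans (n%n≡0 N) (sym z)))

  CycleE-suc : ∀ {x y : Fin N} → suc (toℕ x) % N ≡ toℕ y → CycleE N x y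
  CycleE-suc {x} {y} e with m≤n⇒m<n∨m≡n (toℕ<n x)
  ... | inj₁ lt = inj₁ (trans (sym (m<n⇒m%n≡m lt)) e)
  ... | inj₂ eq = inj₂ (inj₂ (inj₁ (eq , trans (sym e) (trans (cong (_% N) eq) (n%n≡0 N)))))

  CycleE-sym : ∀ {x y : Fin N} → CycleE N x y → CycleE N y x
  CycleE-sym (inj₁ e) = inj₂ (inj₁ e)
  CycleE-sym (inj₂ (inj₁ e)) = inj₁ e
  CycleE-sym (inj₂ (inj₂ (inj₁ e))) = inj₂ (inj₂ (inj₂ e))
  CycleE-sym (inj₂ (inj₂ (inj₂ e))) = inj₂ (inj₂ (inj₁ e))

  Indχ : Subset N → Set
  Indχ X = ∀ v → χ X v ≡ true → χ X (suc v) ≡ true → ⊥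

  Domχ : Subset N → Set
  Domχ X = ∀ v → (χ X v ∨ χ X (suc v) ∨ χ X (suc (suc v))) ≡ true

  CycleE-fin : ∀ v → CycleE N (fin v) (fin (suc v))
  CycleE-fin v = CycleE-suc (trans (cong (λ t → suc t % N) (toℕ-fin v)) (trans (mod-suc v) (sym (toℕ-fin (suc v)))))

  Independent⇒Indχ : ∀ X → Independent G X → Indχ X
  Independent⇒Indχ X indep v b1 b2 = indep (fin v) (fin (suc v)) (χ⇒∈ {X} {v} b1) (χ⇒∈ {X} {suc v} b2) (CycleE-fin v)

  Indχ⇒Independent : ∀ X → Indχ X → Independent G X
  Indχ⇒Independent X ib x y mx my e with CycleE⇒ e
  ... | inj₁ q = ib (toℕ x) (∈⇒χ mx) (trans (χ-def X _) (trans (cong (lookupℕ X) q) (trans (sym (χ-toℕ X y)) (∈⇒χ my))))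
  ... | inj₂ q = ib (toℕ y) (∈⇒χ my) (trans (χ-def X _) (trans (cong (lookupℕ X) q) (trans (sym (χ-toℕ X x)) (∈⇒χ mx))))

  Dominating⇒Domχ : ∀ X → Dominating G X → Domχ X
  Dominating⇒Domχ X dom v with dom (fin (suc v))
  ... | inj₁ m = ∨₃-intro₂ (χ X v) (χ X (suc (suc v))) (trans (sym (lookupℕ-fin X (suc v))) (∈⇒lookupℕ m))
  ... | inj₂ (u , mu , e) with CycleE⇒ e
  ...   | inj₁ q = ∨₃-intro₁ (χ X (suc v)) (χ X (suc (suc v))) (trans (χ-cong X (sym u≡v)) (∈⇒χ mu))
    where
    u≡v : toℕ u % N ≡ v % N
    u≡v = suc-mod-injective {toℕ u} {v} (trans q (toℕ-fin (suc v)))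
  ...   | inj₂ q = ∨₃-intro₃ (χ X v) (χ X (suc v)) (trans (χ-cong X u≡2+v) (∈⇒χ mu))
    where
    u≡2+v : suc (suc v) % N ≡ toℕ u % N
    u≡2+v = trans (sym (mod-suc (suc v))) (trans (cong (λ t → suc t % N) (sym (toℕ-fin (suc v))))
              (trans q (sym (m<n⇒m%n≡m (toℕ<n u)))))

  Domχ⇒Dominating : ∀ X → Domχ X → Dominating G X
  Domχ⇒Dominating X db c with ∨₃-true (χ X (toℕ c + N-1)) (χ X (suc (toℕ c + N-1))) (χ X (suc (suc (toℕ c + N-1)))) (db
      (toℕ c + N-1))
  ... | inj₁ b = inj₂ (fin (toℕ c + N-1) , χ⇒∈ {X} {toℕ c + N-1} b , CycleE-suc eq)
    where
    eq : suc (toℕ (fin (toℕ c + N-1))) % N ≡ toℕ c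
    eq = trans (cong (λ t → suc t % N) (toℕ-fin (toℕ c + N-1))) (trans (mod-suc (toℕ c + N-1)) (trans (cong (_% N) (sym (+-suc
        (toℕ c) N-1))) (trans ([m+n]%n≡m%n (toℕ c) N) (m<n⇒m%n≡m (toℕ<n c)))))
  ... | inj₂ (inj₁ b) = inj₁ (lookupℕ⇒∈ (trans (sym (χ-toℕ X c)) (trans (χ-cong X (sym (trans (cong (_% N) (sym (+-suc
      (toℕ c) N-1))) ([m+n]%n≡m%n (toℕ c) N)))) b)))
  ... | inj₂ (inj₂ b) = inj₂ (fin (suc (suc (toℕ c + N-1))) , χ⇒∈ {X} {suc (suc (toℕ c + N-1))} b , CycleE-sym (CycleE-suc eq))
    where
    eq : suc (toℕ c) % N ≡ toℕ (fin (suc (suc (toℕ c + N-1))))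
    eq = trans (sym (trans (cong (_% N) (cong suc (sym (+-suc (toℕ c) N-1)))) ([m+n]%n≡m%n (suc (toℕ c)) N))) (sym (toℕ-fin (suc
        (suc (toℕ c + N-1)))))

  𝟙 : Subset N → ℕ → ℕ
  𝟙 X v = bit (χ X v)

  weight : Subset N → ℕ → ℕ
  weight X v = 𝟙 X v + 𝟙 X (suc v) + 𝟙 X (suc (suc v))

  ∣∣≡Σ𝟙 : ∀ X → ∣ X ∣ ≡ Σ< N (𝟙 X)
  ∣∣≡Σ𝟙 X = trans (∣∣≡Σ-lookupℕ X) (Σ-cong N (λ v p → cong bit (sym (trans (χ-def X v) (cong (lookupℕ X) (m<n⇒m%n≡m p))))))

  Σ-weight : ∀ X → Σ< N (weight X) ≡ 3 * ∣ X ∣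
  Σ-weight X = begin
      Σ< N (weight X)
    ≡⟨ Σ-+ N (λ v → 𝟙 X v + 𝟙 X (suc v)) (λ v → 𝟙 X (suc (suc v))) ⟩
      Σ< N (λ v → 𝟙 X v + 𝟙 X (suc v)) + Σ< N (λ v → 𝟙 X (suc (suc v)))
    ≡⟨ cong₂ _+_ (Σ-+ N (𝟙 X) (λ v → 𝟙 X (suc v))) (trans (Σ-shift N (λ v → 𝟙 X (suc v)) (cong bit (χ-periodic X 1))) (Σ-shift N
        (𝟙 X) (cong bit (χ-periodic X 0)))) ⟩
      Σ< N (𝟙 X) + Σ< N (λ v → 𝟙 X (suc v)) + Σ< N (𝟙 X)
    ≡⟨ cong (λ t → Σ< N (𝟙 X) + t + Σ< N (𝟙 X)) (Σ-shift N (𝟙 X) (cong bit (χ-periodic X 0))) ⟩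
      S + S + S
    ≡⟨ cong (λ t → t + t + t) (sym (∣∣≡Σ𝟙 X)) ⟩
      ∣ X ∣ + ∣ X ∣ + ∣ X ∣
    ≡⟨ trans (+-assoc ∣ X ∣ _ _) (cong (∣ X ∣ +_) (cong (∣ X ∣ +_) (sym (+-identityʳ ∣ X ∣)))) ⟩
      3 * ∣ X ∣ ∎
    where
    open ≡-Reasoning
    S = Σ< N (𝟙 X)

  weight≥1 : ∀ X → Domχ X → ∀ v → 1 ≤ weight X v
  weight≥1 X d v with χ X v | χ X (suc v) | χ X (suc (suc v)) | d v
  ... | true | _ | _ | _ = s≤s z≤n
  ... | false | true | _ | _ = s≤s z≤n
  ... | false | false | true | _ = s≤s z≤n
  ... | false | false | false | ()

  weight≤2 : ∀ X → Indχ X → ∀ v → weight X v ≤ 2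
  weight≤2 X ib v with χ X v in e0 | χ X (suc v) in e1 | χ X (suc (suc v)) in e2
  ... | true | true | _ = ⊥-elim (ib v e0 e1)
  ... | _ | true | true = ⊥-elim (ib (suc v) e1 e2)
  ... | true | false | true = ≤-refl
  ... | true | false | false = s≤s z≤n
  ... | false | false | true = s≤s z≤n
  ... | false | false | false = z≤n
  ... | false | true | false = s≤s z≤n

  N≤3∣∣ : ∀ X → Domχ X → N ≤ 3 * ∣ X ∣
  N≤3∣∣ X d = subst₂ _≤_ (Σ-ones N) (Σ-weight X) (Σ-mono N (λ v _ → weight≥1 X d v))

  IndepDom⇒χ : ∀ X → IndepDom G X → Indχ X × Domχ X
  IndepDom⇒χ X (i , d) = Independent⇒Indχ X i , Dominating⇒Domχ X d

  χ⇒IndepDom : ∀ X → Indχ X → Domχ X → IndepDom G X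
  χ⇒IndepDom X i d = Indχ⇒Independent X i , Domχ⇒Dominating X d

  record Optimal (X : Subset N) : Set where
    constructor optimal
    field
      opt-ind : Indχ X
      opt-dom : Domχ X
      opt-size : ∣ X ∣ ≡ ⌈/3⌉ N

  open Optimal public

  Optimal⇒IsISet : ∀ X → Optimal X → IsISet G X
  Optimal⇒IsISet X (optimal i d c) = χ⇒IndepDom X i d , λ Y idy → subst (_≤ ∣ Y ∣) (sym c) (⌈/3⌉-least N ∣ Y ∣ (N≤3∣∣ Y (proj₂
      (IndepDom⇒χ Y idy))))

  IsISet⇒Optimal : ∀ Z → Optimal Z → ∀ X → IsISet G X → Optimal X
  IsISet⇒Optimal Z gz X (idx , mn) = optimal (proj₁ (IndepDom⇒χ X idx)) (proj₂ (IndepDom⇒χ X idx))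
    (≤-antisym (subst (∣ X ∣ ≤_) (opt-size gz) (mn Z (χ⇒IndepDom Z (opt-ind gz) (opt-dom gz)))) (⌈/3⌉-least N ∣ X ∣ (N≤3∣∣ X
        (proj₂ (IndepDom⇒χ X idx)))))

  Σ-weight-optimal : ∀ X → Optimal X → Σ< N (weight X) ≡ 3 * ⌈/3⌉ N
  Σ-weight-optimal X g = trans (Σ-weight X) (cong (3 *_) (opt-size g))

  χ-suc+N-1 : ∀ X v → χ X (suc v + N-1) ≡ χ X v
  χ-suc+N-1 X v = trans (cong (χ X) (sym (+-suc v N-1))) (χ-periodic X v)

  -- c − 1 is written c + N-1 to avoid truncated subtraction.
  Centre : Subset N → ℕ → Set
  Centre X c = χ X (c + N-1) ≡ true × χ X (suc c) ≡ true

  centre? : Subset N → ℕ → Bool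
  centre? X c = χ X (c + N-1) ∧ χ X (suc c)

  centre?⇒Centre : ∀ X c → centre? X c ≡ true → Centre X c
  centre?⇒Centre X c e with χ X (c + N-1) | χ X (suc c)
  ... | true | true = refl , refl

  Centre⇒centre? : ∀ X c → Centre X c → centre? X c ≡ true
  Centre⇒centre? X c (a , b) rewrite a | b = refl

  centre∉ : ∀ X → Indχ X → ∀ c → Centre X c → χ X c ≡ false
  centre∉ X ib c (a , b) with χ X c in e
  ... | true = ⊥-elim (ib c e b)
  ... | false = refl

  centre-weight : ∀ X → Indχ X → ∀ c → Centre X c → weight X (c + N-1) ≡ 2
  centre-weight X ib c (a , b) rewrite a | χ-suc+N-1 X c | centre∉ X ib c (a , b) | χ-suc+N-1 X (suc c) | b = refl

  weight2⇒centre : ∀ X → Indχ X → ∀ v → weight X v ≡ 2 → Centre X (suc v)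
  weight2⇒centre X ib v e with χ X v in e0 | χ X (suc v) in e1 | χ X (suc (suc v)) in e2
  ... | true | true | _ = ⊥-elim (ib v e0 e1)
  ... | _ | true | true = ⊥-elim (ib (suc v) e1 e2)
  ... | true | false | true = trans (χ-suc+N-1 X v) e0 , refl
  weight2⇒centre X ib v () | true | false | false
  weight2⇒centre X ib v () | false | false | true
  weight2⇒centre X ib v () | false | false | false
  weight2⇒centre X ib v () | false | true | false

  mod-suc² : ∀ v → suc (suc (v % N)) % N ≡ suc (suc v) % N
  mod-suc² v = trans (sym (mod-suc (suc (v % N)))) (trans (cong (λ t → suc t % N) (mod-suc v)) (mod-suc (suc v)))

  weight-mod : ∀ X v → weight X (v % N) ≡ weight X v
  weight-mod X v = cong₂ _+_ (cong₂ _+_ (cong bit (χ-cong X (mod-idem v))) (cong bit (χ-cong X (mod-suc v)))) (cong bit (χ-cong X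
      (mod-suc² v)))

  Centre-mod : ∀ X c → Centre X c → Centre X (c % N)
  Centre-mod X c (a , b) = trans (χ-cong X (trans (mod-+ c N-1) refl)) a , trans (χ-cong X (mod-suc c)) b

  Centre-cong : ∀ X {c d} → c % N ≡ d % N → Centre X c → Centre X d
  Centre-cong X {c} {d} e (a , b) = trans (χ-cong X (trans (sym (mod-+ d N-1)) (trans (cong (λ t → (t + N-1) % N) (sym e))
      (mod-+ c N-1)))) a ,
                                 trans (χ-cong X (trans (sym (mod-suc d)) (trans (cong (λ t → suc t % N) (sym e)) (mod-suc c)))) b

  +N-1-mod-injective : ∀ {a b} → (a + N-1) % N ≡ (b + N-1) % N → a % N ≡ b % N
  +N-1-mod-injective {a} {b} e = trans (sym (l a)) (trans (+-mod-cong {a + N-1} {b + N-1} 1 e) (l b))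
    where
    l : ∀ x → (x + N-1 + 1) % N ≡ x % N
    l x = trans (cong (_% N) (trans (+-assoc x N-1 1) (trans (cong (x +_) (+-comm N-1 1)) refl))) ([m+n]%n≡m%n x N)

  window : ℕ → ℕ
  window c = (c + N-1) % N

  window<N : ∀ c → window c < N
  window<N c = m%n<n (c + N-1) N

  weight-window : ∀ X → Indχ X → ∀ c → Centre X c → weight X (window c) ≡ 2
  weight-window X ib c ce = trans (weight-mod X (c + N-1)) (centre-weight X ib c ce)

  Σ-rotate : ∀ e (f : ℕ → ℕ) → Σ< N (λ v → f ((v + e) % N)) ≡ Σ< N f
  Σ-rotate zero f = Σ-cong N (λ v p → cong f (trans (cong (_% N) (+-identityʳ v)) (m<n⇒m%n≡m p)))
  Σ-rotate (suc e) f = begin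
      Σ< N (λ v → f ((v + suc e) % N))
    ≡⟨ Σ-cong N (λ v p → cong f (trans (cong (_% N) (+-suc v e)) (sym (mod-suc (v + e))))) ⟩
      Σ< N (λ v → g ((v + e) % N))
    ≡⟨ Σ-rotate e g ⟩
      Σ< N g
    ≡⟨ Σ-shift N F (cong f (n%n≡0 N)) ⟩
      Σ< N F
    ≡⟨ Σ-cong N (λ v p → cong f (m<n⇒m%n≡m p)) ⟩
      Σ< N f ∎
    where
    open ≡-Reasoning
    g : ℕ → ℕ
    g u = f (suc u % N)
    F : ℕ → ℕ
    F u = f (u % N)

  offset : ℕ → ℕ
  offset a = N ∸ a % N

  +offset : ∀ a → a + offset a ≡ N + (a / N) * N
  +offset a = trans (cong (_+ offset a) (m≡m%n+[m/n]*n a N)) (trans (+-assoc (a % N) _ _) (trans (cong (a % N +_) (+-comm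
      ((a / N) * N) (offset a))) (trans (sym (+-assoc (a % N) (offset a) _)) (cong (_+ (a / N) * N) (m+[n∸m]≡n (m%n≤n a N))))))

  +offset-mod : ∀ a x → (x + (a + offset a)) % N ≡ x % N
  +offset-mod a x = trans (cong (λ t → (x + t) % N) (+offset a)) (trans (cong (_% N) (sym (+-assoc x N _))) (trans ([m+kn]%n≡m%n
      (x + N) (a / N) N) ([m+n]%n≡m%n x N)))

  opaque
    place : ℕ → (ℕ → Bool) → Subset N
    place a q = tabulate (λ i → q ((toℕ i + offset a) % N))

  opaque
    unfolding place
    χ-place : ∀ a q v → χ (place a q) v ≡ q ((v + offset a) % N)
    χ-place a q v = trans (χ-def (place a q) v) (trans (lookupℕ-tabulate (λ u → q ((u + offset a) % N)) (v % N) (m%n<n v N))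
        (cong q (mod-+ v (offset a))))

    place-cong : ∀ {a b} q → a % N ≡ b % N → place a q ≡ place b q
    place-cong q e = cong (λ d → tabulate (λ i → q ((toℕ i + d) % N))) (cong (N ∸_) e)

  χ-place-from : ∀ a q o → χ (place a q) (a + o) ≡ q (o % N)
  χ-place-from a q o = trans (χ-place a q (a + o)) (cong q (trans (cong (_% N) (trans (+-assoc a o (offset a)) (trans (cong (a +_)
      (+-comm o (offset a))) (trans (sym (+-assoc a (offset a) o)) (+-comm (a + offset a) o))))) (+offset-mod a o)))

  mod-+ˡ : ∀ a x → (a + x % N) % N ≡ (a + x) % N
  mod-+ˡ a x = trans (cong (_% N) (+-comm a (x % N))) (trans (mod-+ x a) (cong (_% N) (+-comm x a)))

  place-unique : ∀ X a q → (∀ o → o < N → χ X (a + o) ≡ q o) → X ≡ place a q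
  place-unique X a q h = lookupℕ-ext X (place a q) pw
    where
    pw : ∀ v → v < N → lookupℕ X v ≡ lookupℕ (place a q) v
    pw v p = begin
        lookupℕ X v
      ≡⟨ cong (lookupℕ X) (sym (m<n⇒m%n≡m p)) ⟩
        lookupℕ X (v % N)
      ≡⟨ sym (χ-def X v) ⟩
        χ X v
      ≡⟨ χ-cong X (sym (trans (mod-+ˡ a (v + offset a)) (trans (cong (_% N) (trans (sym (+-assoc a v (offset a))) (trans (cong
          (_+ offset a) (+-comm a v)) (+-assoc v a (offset a))))) (+offset-mod a v)))) ⟩
        χ X (a + o)
      ≡⟨ h o (m%n<n (v + offset a) N) ⟩
        q o
      ≡⟨ sym (χ-place a q v) ⟩
        χ (place a q) v
      ≡⟨ χ-def (place a q) v ⟩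
        lookupℕ (place a q) (v % N)
      ≡⟨ cong (lookupℕ (place a q)) (m<n⇒m%n≡m p) ⟩
        lookupℕ (place a q) v ∎
      where
      open ≡-Reasoning
      o = (v + offset a) % N

  record Pattern (q : ℕ → Bool) : Set where
    field
      starts-in : q 0 ≡ true
      ends-out : q N-1 ≡ false
      independent : ∀ o → suc o < N → q o ≡ true → q (suc o) ≡ true → ⊥
      dominating : ∀ o → suc (suc o) < N → (q o ∨ q (suc o) ∨ q (suc (suc o))) ≡ true

  module _ {q : ℕ → Bool} (P : Pattern q) where
    open Pattern P

    pattern-ind : ∀ t → q (t % N) ≡ true → q (suc t % N) ≡ true → ⊥
    pattern-ind t e1 e2 with m≤n⇒m<n∨m≡n (m%n<n t N)
    ... | inj₁ lt = independent (t % N) lt e1 (trans (cong q (sym (trans (sym (mod-suc t)) (m<n⇒m%n≡m lt)))) e2)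
    ... | inj₂ eq = bad (trans (sym ends-out) (trans (cong q (suc-injective (sym eq))) e1))
      where
      bad : false ≡ true → ⊥
      bad ()

    pattern-dom : ∀ t → (q (t % N) ∨ q (suc t % N) ∨ q (suc (suc t) % N)) ≡ true
    pattern-dom t with m≤n⇒m<n∨m≡n (m%n<n t N)
    ... | inj₂ eq = ∨₃-intro₂ (q (t % N)) (q (suc (suc t) % N)) (trans (cong q (trans (sym (mod-suc t)) (trans (cong (_% N) eq)
        (n%n≡0 N)))) starts-in)
    ... | inj₁ lt with m≤n⇒m<n∨m≡n lt
    ...   | inj₂ eq = ∨₃-intro₃ (q (t % N)) (q (suc t % N)) (trans (cong q (trans (sym (mod-suc² t)) (trans (cong (_% N) eq)
        (n%n≡0 N)))) starts-in)
    ...   | inj₁ lt2 = subst₂ (λ u v → (q (t % N) ∨ q u ∨ q v) ≡ true)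
                          (trans (sym (m<n⇒m%n≡m lt)) (mod-suc t)) (trans (sym (m<n⇒m%n≡m lt2)) (mod-suc² t)) (dominating
                              (t % N) lt2)

    Indχ-place : ∀ a → Indχ (place a q)
    Indχ-place a v e1 e2 = pattern-ind (v + offset a) (trans (sym (χ-place a q v)) e1) (trans (sym (χ-place a q (suc v))) e2)

    Domχ-place : ∀ a → Domχ (place a q)
    Domχ-place a v = subst (λ t → t ≡ true) (sym (cong₂ _∨_ (χ-place a q v) (cong₂ _∨_ (χ-place a q (suc v)) (χ-place a q (suc
        (suc v)))))) (pattern-dom (v + offset a))

    ∣place∣ : ∀ a → ∣ place a q ∣ ≡ Σ< N (λ v → bit (q v))
    ∣place∣ a = trans (∣∣≡Σ𝟙 (place a q)) (trans (Σ-cong N (λ v _ → cong bit (χ-place a q v))) (Σ-rotate (offset a) (λ v → bit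
        (q v))))

    Optimal-place : ∀ a → Σ< N (λ v → bit (q v)) ≡ ⌈/3⌉ N → Optimal (place a q)
    Optimal-place a e = optimal (Indχ-place a) (Domχ-place a) (trans (∣place∣ a) e)

  +-mod-≢ : ∀ v d → 0 < d → d < N → (v + d) % N ≢ v % N
  +-mod-≢ v d dp dN e with (v % N + d) <? N
  ... | yes lt = 0<0 (subst (0 <_) dz dp)
    where
    0<0 : 0 < 0 → ⊥
    0<0 ()
    e1 : v % N + d ≡ v % N
    e1 = trans (sym (m<n⇒m%n≡m lt)) (trans (mod-+ v d) e)
    dz : d ≡ 0
    dz = +-cancelˡ-≡ (v % N) d 0 (trans e1 (sym (+-identityʳ _)))
  ... | no ge = <-irrefl (+-cancelˡ-≡ (v % N) d N e2) dN
    where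
    ge' : N ≤ v % N + d
    ge' = ≮⇒≥ ge
    z = v % N + d ∸ N
    zeq : z + N ≡ v % N + d
    zeq = m∸n+n≡m ge'
    zlt : z < N
    zlt = +-cancelʳ-< N z N (subst (_< N + N) (sym zeq) (+-mono-< (m%n<n v N) dN))
    e1 : z ≡ v % N
    e1 = trans (sym (m<n⇒m%n≡m zlt)) (trans (sym ([m+n]%n≡m%n z N)) (trans (cong (_% N) zeq) (trans (mod-+ v d) e)))
    e2 : v % N + d ≡ v % N + N
    e2 = trans (sym zeq) (cong (_+ N) e1)

  +-mod-≢′ : ∀ u i j → i < j → j < i + N → (i + u) % N ≢ (j + u) % N
  +-mod-≢′ u i j p q e = +-mod-≢ (i + u) (j ∸ i) (m<n⇒0<n∸m p) dlt (trans (cong (_% N) ar) (sym e))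
    where
    jeq : i + (j ∸ i) ≡ j
    jeq = m+[n∸m]≡n (<⇒≤ p)
    dlt : j ∸ i < N
    dlt = +-cancelˡ-< i (j ∸ i) N (subst (_< i + N) (sym jeq) q)
    ar : i + u + (j ∸ i) ≡ j + u
    ar = trans (+-assoc i u (j ∸ i)) (trans (cong (i +_) (+-comm u (j ∸ i))) (trans (sym (+-assoc i (j ∸ i) u)) (cong
        (_+ u) jeq)))

  weight1⊎centre : ∀ X → Indχ X → Domχ X → ∀ v → weight X v ≡ 1 ⊎ Centre X (suc v)
  weight1⊎centre X ib db v with weight X v in e | weight≥1 X db v | weight≤2 X ib v
  ... | suc zero | _ | _ = inj₁ refl
  ... | suc (suc zero) | _ | _ = inj₂ (weight2⇒centre X ib v e)
  ... | zero | () | _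
  ... | suc (suc (suc _)) | _ | s≤s (s≤s ())

  χ-segment : ∀ X → Indχ X → ∀ a → χ X a ≡ true → ∀ L → (∀ o → o < L → weight X (a + o) ≡ 1) →
         ∀ o → o < suc (suc L) → χ X (a + o) ≡ every3rd o
  χ-segment X ib a ba L h = Segment.segment c indc c0 L h'
    where
    c : ℕ → Bool
    c o = χ X (a + o)
    indc : ∀ o → c o ≡ true → c (suc o) ≡ true → ⊥
    indc o e1 e2 = ib (a + o) e1 (trans (cong (χ X) (sym (+-suc a o))) e2)
    c0 : c 0 ≡ true
    c0 = trans (cong (χ X) (+-identityʳ a)) ba
    h' : ∀ o → o < L → Segment.weight c indc c0 o ≡ 1
    h' o p = trans (cong₂ _+_ (cong₂ _+_ refl (cong bit (cong (χ X) (+-suc a o)))) (cong bit (cong (χ X) (trans (+-suc a (suc o))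
        (cong suc (+-suc a o)))))) (h o p)

  χ-from-centre : ∀ X → Optimal X → ∀ c L → Centre X c → (∀ o → o < L → ¬ Centre X (suc (suc c + o))) →
                  ∀ o → o < suc (suc L) → χ X (suc c + o) ≡ every3rd o
  χ-from-centre X g c L ce none = χ-segment X (opt-ind g) (suc c) (proj₂ ce) L weight≡1
    where
    weight≡1 : ∀ o → o < L → weight X (suc c + o) ≡ 1
    weight≡1 o p with weight1⊎centre X (opt-ind g) (opt-dom g) (suc c + o)
    ... | inj₁ e = e
    ... | inj₂ ct = ⊥-elim (none o p ct)

  iset-ext : ∀ {X Y : ISet G} → ISet.set X ≡ ISet.set Y → X ≡ Y
  iset-ext {iset s p} {iset .s q} refl = refl

  CycleE? : ∀ (x y : Fin N) → Dec (CycleE N x y)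
  CycleE? x y = (suc (toℕ x) ≟ toℕ y) ⊎-dec ((suc (toℕ y) ≟ toℕ x) ⊎-dec (((suc (toℕ x) ≟ N) ×-dec (toℕ y ≟ 0)) ⊎-dec ((suc
      (toℕ y) ≟ N) ×-dec (toℕ x ≟ 0))))

  ∈? : ∀ (x : Fin N) (X : Subset N) → Dec (x ∈ X)
  ∈? x X with lookup X x in e
  ... | true = yes (lookup⇒[]= x X e)
  ... | false = no (λ m → true≢false (trans (sym ([]=⇒lookup m)) e))

  ≡? : ∀ (X Y : Subset N) → Dec (X ≡ Y)
  ≡? = Data.Vec.Properties.≡-dec Data.Bool._≟_

  Slide : Subset N → Subset N → Fin N → Fin N → Set
  Slide X Y x y = CycleE N x y × x ∈ X × y ∉ X × Y ≡ (X - x) ∪ ⁅ y ⁆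

  Slide? : ∀ X Y x y → Dec (Slide X Y x y)
  Slide? X Y x y = CycleE? x y ×-dec (∈? x X ×-dec (¬? (∈? y X) ×-dec ≡? Y ((X - x) ∪ ⁅ y ⁆)))

module Slides (n'' : ℕ) where

  open OnCycle (suc n'')

  +-mod-≢″ : ∀ u i k → 0 < k → k < N → (i + u) % N ≢ ((i + k) + u) % N
  +-mod-≢″ u i k p q = +-mod-≢′ u i (i + k) (subst (_< i + k) (+-identityʳ i) (+-monoʳ-< i p)) (+-monoʳ-< i q)

  +N-1-mod-pred : ∀ p v → (p + N-1) % N ≡ v % N → p % N ≡ suc v % N
  +N-1-mod-pred p v e = +N-1-mod-injective {p} {suc v} (trans e (sym (trans (cong (_% N) (sym (+-suc v N-1))) ([m+n]%n≡m%n v N))))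

  record CentreShift (X Y : Subset N) : Set where
    field
      cX cY : ℕ
      cenX : Centre X cX
      cenY : Centre Y cY
      shift : (cX + 3) % N ≡ cY % N ⊎ (cY + 3) % N ≡ cX % N
      notCenX : ¬ Centre X cY
      persist : ∀ p → Centre X p → p % N ≢ cX % N → Centre Y p

  module SlidedSet (X Y : Subset N) (x y : Fin N) (eqY : Y ≡ (X - x) ∪ ⁅ y ⁆) where

    tx = toℕ x
    ty = toℕ y

    χ-slided : ∀ v → χ Y v ≡ (χ X v ∧ not (v % N ≡ᵇ tx)) ∨ (v % N ≡ᵇ ty)
    χ-slided v = trans (χ-def Y v) (trans (cong (λ Z → lookupℕ Z (v % N)) eqY) (trans (lookupℕ-∪ (X - x) ⁅ y ⁆ (v % N))
             (cong₂ _∨_ (trans (lookupℕ-remove X x (v % N)) (cong (λ t → t ∧ not ((v % N) ≡ᵇ tx)) (sym (χ-def X v))))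
                 (lookupℕ-⁅⁆ y (v % N)))))

    χ-kept : ∀ v → v % N ≢ tx → χ X v ≡ true → χ Y v ≡ true
    χ-kept v ne e rewrite χ-slided v | e | ≢⇒≡ᵇfalse ne = refl

    χ-back : ∀ v → v % N ≢ ty → χ Y v ≡ true → χ X v ≡ true
    χ-back v ne e rewrite χ-slided v | ≢⇒≡ᵇfalse ne with χ X v
    ... | true = refl
    χ-back v ne () | false

    χ-removed : ∀ v → v % N ≡ tx → v % N ≢ ty → χ Y v ≡ false
    χ-removed v e ne rewrite χ-slided v | ≡⇒≡ᵇtrue e | ≢⇒≡ᵇfalse ne with χ X v
    ... | true = refl
    ... | false = refl

    χ-added : ∀ v → v % N ≡ ty → χ Y v ≡ true
    χ-added v e rewrite χ-slided v | ≡⇒≡ᵇtrue e = Data.Bool.Properties.∨-zeroʳ _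

    χ-absent : ∀ v → v % N ≢ ty → χ X v ≡ false → χ Y v ≡ false
    χ-absent v ne e rewrite χ-slided v | e | ≢⇒≡ᵇfalse ne = refl

  module SlideCentres (X Y : Subset N) (x y : Fin N) (eqY : Y ≡ (X - x) ∪ ⁅ y ⁆)
    (ibX : Indχ X) (dbX : Domχ X) (ibY : Indχ Y) (dbY : Domχ Y)
    (xX : χ X (toℕ x) ≡ true) (yX : χ X (toℕ y) ≡ false) where

    open SlidedSet X Y x y eqY

    txN : tx % N ≡ tx
    txN = m<n⇒m%n≡m (toℕ<n x)
    tyN : ty % N ≡ ty
    tyN = m<n⇒m%n≡m (toℕ<n y)

    module Plus (dir : suc tx % N ≡ ty) where
      u = tx + suc (suc n'')
      e2 : (2 + u) % N ≡ tx
      e2 = trans (cong (_% N) (trans (cong suc (sym (+-suc tx (suc (suc n''))))) (sym (+-suc tx (suc (suc (suc n''))))))) (trans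
          ([m+n]%n≡m%n tx N) txN)
      e3 : (3 + u) % N ≡ ty
      e3 = trans (sym (mod-suc (2 + u))) (trans (cong (λ t → suc t % N) e2) dir)
      bx2 : χ X (2 + u) ≡ true
      bx2 = trans (χ-cong X (trans e2 (sym txN))) xX
      bx3 : χ X (3 + u) ≡ false
      bx3 = trans (χ-cong X (trans e3 (sym tyN))) yX
      bx1 : χ X (1 + u) ≡ false
      bx1 = ≢true⇒false (λ e → ibX (1 + u) e bx2)
      by2 : χ Y (2 + u) ≡ false
      by2 = χ-removed (2 + u) e2 (λ e → +-mod-≢″ u 2 1 (s≤s z≤n) (s≤s (s≤s z≤n)) (trans e (sym e3)))
      by1 : χ Y (1 + u) ≡ false
      by1 = χ-absent (1 + u) (λ e → +-mod-≢″ u 1 2 (s≤s z≤n) (s≤s (s≤s (s≤s z≤n))) (trans e (sym e3))) bx1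
      bx0 : χ X u ≡ true
      bx0 = χ-back u (λ e → +-mod-≢″ u 0 3 (s≤s z≤n) (s≤s (s≤s (s≤s (s≤s z≤n)))) (trans e (sym e3))) (∨₃-first (dbY u) by1 by2)
      by3 : χ Y (3 + u) ≡ true
      by3 = χ-added (3 + u) e3
      bx4 : χ X (4 + u) ≡ false
      bx4 = ≢true⇒false (λ e → ibY (3 + u) by3 (χ-kept (4 + u) (λ e' → +-mod-≢″ u 2 2 (s≤s z≤n) (s≤s (s≤s (s≤s z≤n))) (trans e2
          (sym e'))) e))
      by5 : χ Y (5 + u) ≡ true
      by5 = χ-kept (5 + u) (λ e' → +-mod-≢″ u 2 3 (s≤s z≤n) (s≤s (s≤s (s≤s (s≤s z≤n)))) (trans e2 (sym e'))) (∨₃-third (dbX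
          (3 + u)) bx3 bx4)

      res : CentreShift X Y
      res = record
        { cX = 1 + u
        ; cY = 4 + u
        ; cenX = trans (χ-suc+N-1 X u) bx0 , bx2
        ; cenY = trans (χ-suc+N-1 Y (3 + u)) by3 , by5
        ; shift = inj₁ (cong (_% N) (cong suc (+-comm u 3)))
        ; notCenX = λ c → x≡true⇒x≢false (trans (sym (χ-suc+N-1 X (3 + u))) (proj₁ c)) bx3
        ; persist = pers
        }
        where
        pers : ∀ p → Centre X p → p % N ≢ (1 + u) % N → Centre Y p
        pers p (c1 , c2) ne = χ-kept (p + N-1) n1 c1 , χ-kept (suc p) n2 c2
          where
          not3 : p % N ≢ (3 + u) % N
          not3 e = x≡true⇒x≢false (proj₂ (Centre-cong X {p} {3 + u} e (c1 , c2))) bx4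
          n1 : (p + N-1) % N ≢ tx
          n1 e = not3 (+N-1-mod-pred p (2 + u) (trans e (sym e2)))
          n2 : suc p % N ≢ tx
          n2 e = ne (suc-mod-injective {p} {1 + u} (trans e (sym e2)))

    module Minus (dir : suc ty % N ≡ tx) where
      u = tx + suc n''
      e3 : (3 + u) % N ≡ tx
      e3 = trans (cong (_% N) (trans (cong (λ t → suc (suc t)) (sym (+-suc tx (suc n'')))) (trans (cong suc (sym (+-suc tx (suc
          (suc n''))))) (sym (+-suc tx (suc (suc (suc n'')))))))) (trans ([m+n]%n≡m%n tx N) txN)
      e2 : (2 + u) % N ≡ ty
      e2 = trans (sym (suc-mod-injective {ty} {2 + u} (trans dir (sym e3)))) tyN
      bx3 : χ X (3 + u) ≡ true
      bx3 = trans (χ-cong X (trans e3 (sym txN))) xX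
      bx2 : χ X (2 + u) ≡ false
      bx2 = trans (χ-cong X (trans e2 (sym tyN))) yX
      bx4 : χ X (4 + u) ≡ false
      bx4 = ≢true⇒false (λ e → ibX (3 + u) bx3 e)
      by3 : χ Y (3 + u) ≡ false
      by3 = χ-removed (3 + u) e3 (λ e → +-mod-≢″ u 2 1 (s≤s z≤n) (s≤s (s≤s z≤n)) (trans e2 (sym e)))
      by4 : χ Y (4 + u) ≡ false
      by4 = χ-absent (4 + u) (λ e → +-mod-≢″ u 2 2 (s≤s z≤n) (s≤s (s≤s (s≤s z≤n))) (trans e2 (sym e))) bx4
      bx5 : χ X (5 + u) ≡ true
      bx5 = χ-back (5 + u) (λ e → +-mod-≢″ u 2 3 (s≤s z≤n) (s≤s (s≤s (s≤s (s≤s z≤n)))) (trans e2 (sym e))) (∨₃-third (dbY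
          (3 + u)) by3 by4)
      by2 : χ Y (2 + u) ≡ true
      by2 = χ-added (2 + u) e2
      bx1 : χ X (1 + u) ≡ false
      bx1 = ≢true⇒false (λ e → ibY (1 + u) (χ-kept (1 + u) (λ e' → +-mod-≢″ u 1 2 (s≤s z≤n) (s≤s (s≤s (s≤s z≤n))) (trans e'
          (sym e3))) e) by2)
      by0 : χ Y u ≡ true
      by0 = χ-kept u (λ e' → +-mod-≢″ u 0 3 (s≤s z≤n) (s≤s (s≤s (s≤s (s≤s z≤n)))) (trans e' (sym e3))) (∨₃-first (dbX u) bx1 bx2)

      res : CentreShift X Y
      res = record
        { cX = 4 + u
        ; cY = 1 + u
        ; cenX = trans (χ-suc+N-1 X (3 + u)) bx3 , bx5
        ; cenY = trans (χ-suc+N-1 Y u) by0 , by2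
        ; shift = inj₂ (cong (_% N) (cong suc (+-comm u 3)))
        ; notCenX = λ c → x≡true⇒x≢false (proj₂ c) bx2
        ; persist = pers
        }
        where
        pers : ∀ p → Centre X p → p % N ≢ (4 + u) % N → Centre Y p
        pers p (c1 , c2) ne = χ-kept (p + N-1) n1 c1 , χ-kept (suc p) n2 c2
          where
          not2 : p % N ≢ (2 + u) % N
          not2 e = x≡true⇒x≢false (trans (sym (χ-suc+N-1 X (1 + u))) (proj₁ (Centre-cong X {p} {2 + u} e (c1 , c2)))) bx1
          n1 : (p + N-1) % N ≢ tx
          n1 e = ne (+N-1-mod-pred p (3 + u) (trans e (sym e3)))
          n2 : suc p % N ≢ tx
          n2 e = not2 (suc-mod-injective {p} {2 + u} (trans e (sym e3)))

    slide : CycleE N x y → CentreShift X Y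
    slide e with CycleE⇒ e
    ... | inj₁ d = Plus.res d
    ... | inj₂ d = Minus.res d

  lookupℕ-slide : ∀ (X : Subset N) (x y : Fin N) v → lookupℕ ((X - x) ∪ ⁅ y ⁆) v ≡ (lookupℕ X v ∧ not (v ≡ᵇ toℕ x)) ∨ (v ≡ᵇ toℕ y)
  lookupℕ-slide X x y v = trans (lookupℕ-∪ (X - x) ⁅ y ⁆ v) (cong₂ _∨_ (lookupℕ-remove X x v) (lookupℕ-⁅⁆ y v))

  ∣slide∣ : ∀ (X : Subset N) (x y : Fin N) → lookupℕ X (toℕ x) ≡ true → lookupℕ X (toℕ y) ≡ false →
               ∣ (X - x) ∪ ⁅ y ⁆ ∣ ≡ ∣ X ∣
  ∣slide∣ X x y hx hy = +-cancelʳ-≡ 1 _ _ (begin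
      ∣ Z ∣ + 1
    ≡⟨ cong₂ _+_ (∣∣≡Σ-lookupℕ Z) (sym (Σ-indicator N (toℕ x) (toℕ<n x))) ⟩
      Σ< N (λ v → bit (lookupℕ Z v)) + Σ< N (indicator (toℕ x))
    ≡⟨ sym (Σ-+ N (λ v → bit (lookupℕ Z v)) (indicator (toℕ x))) ⟩
      Σ< N (λ v → bit (lookupℕ Z v) + indicator (toℕ x) v)
    ≡⟨ Σ-cong N pw ⟩
      Σ< N (λ v → bit (lookupℕ X v) + indicator (toℕ y) v)
    ≡⟨ Σ-+ N (λ v → bit (lookupℕ X v)) (indicator (toℕ y)) ⟩
      Σ< N (λ v → bit (lookupℕ X v)) + Σ< N (indicator (toℕ y))
    ≡⟨ cong₂ _+_ (sym (∣∣≡Σ-lookupℕ X)) (Σ-indicator N (toℕ y) (toℕ<n y)) ⟩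
      ∣ X ∣ + 1 ∎)
    where
    open ≡-Reasoning
    Z = (X - x) ∪ ⁅ y ⁆
    xy : toℕ x ≢ toℕ y
    xy e = true≢false (trans (sym hx) (trans (cong (lookupℕ X) e) hy))
    lzx : lookupℕ Z (toℕ x) ≡ false
    lzx rewrite lookupℕ-slide X x y (toℕ x) | ≡ᵇ-refl (toℕ x) | ≢⇒≡ᵇfalse xy | hx = refl
    lzy : lookupℕ Z (toℕ y) ≡ true
    lzy rewrite lookupℕ-slide X x y (toℕ y) | ≡ᵇ-refl (toℕ y) = Data.Bool.Properties.∨-zeroʳ _
    lzo : ∀ v → v ≢ toℕ x → v ≢ toℕ y → lookupℕ Z v ≡ lookupℕ X v
    lzo v n1 n2 rewrite lookupℕ-slide X x y v | ≢⇒≡ᵇfalse n1 | ≢⇒≡ᵇfalse n2 = trans (Data.Bool.Properties.∨-identityʳ _)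
        (Data.Bool.Properties.∧-identityʳ _)
    pw : ∀ v → v < N → bit (lookupℕ Z v) + indicator (toℕ x) v ≡ bit (lookupℕ X v) + indicator (toℕ y) v
    pw v _ with v ≟ toℕ x | v ≟ toℕ y
    ... | yes refl | yes e2 = ⊥-elim (xy e2)
    ... | yes refl | no n2 = trans (cong₂ _+_ (cong bit lzx) (indicator-self v)) (sym (cong₂ _+_ (cong bit hx) (indicator-other
        (toℕ y) v n2)))
    ... | no n1 | yes refl = trans (cong₂ _+_ (cong bit lzy) (indicator-other (toℕ x) v n1)) (sym (cong₂ _+_ (cong bit hy)
        (indicator-self v)))
    ... | no n1 | no n2 = cong₂ _+_ (cong bit (lzo v n1 n2)) (trans (indicator-other (toℕ x) v n1) (sym (indicator-other
        (toℕ y) v n2)))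

  module SlideRight (X : Subset N) (ibX : Indχ X) (dbX : Domχ X) (u : ℕ)
    (b0 : χ X u ≡ true) (b2 : χ X (2 + u) ≡ true) (b4 : χ X (4 + u) ≡ false) where

    x = fin (2 + u)
    y = fin (3 + u)
    Z = (X - x) ∪ ⁅ y ⁆
    open SlidedSet X Z x y refl

    ex : tx ≡ (2 + u) % N
    ex = toℕ-fin (2 + u)
    ey : ty ≡ (3 + u) % N
    ey = toℕ-fin (3 + u)

    b3 : χ X (3 + u) ≡ false
    b3 = ≢true⇒false (λ e → ibX (2 + u) b2 e)

    xX : x ∈ X
    xX = χ⇒∈ {X} {2 + u} b2
    yX : χ X ty ≡ false
    yX = trans (χ-cong X (trans (cong (_% N) ey) (mod-idem (3 + u)))) b3
    xXb : χ X tx ≡ true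
    xXb = trans (χ-cong X (trans (cong (_% N) ex) (mod-idem (2 + u)))) b2
    yX' : y ∉ X
    yX' m = true≢false (trans (sym (∈⇒χ m)) yX)
    exy : CycleE N x y
    exy = CycleE-suc (trans (cong (λ t → suc t % N) ex) (trans (mod-suc (2 + u)) (sym ey)))

    IndZ : Indχ Z
    IndZ v e1 e2 with v % N ≟ (3 + u) % N
    ... | yes q with suc v % N ≟ (3 + u) % N
    ...   | yes q' = +-mod-≢″ u 3 1 (s≤s z≤n) (s≤s (s≤s z≤n)) (trans (sym q') (sym r))
      where
      r : (4 + u) % N ≡ suc v % N
      r = trans (sym (mod-suc (3 + u))) (trans (cong (λ t → suc t % N) (sym q)) (mod-suc v))
    ...   | no q' = true≢false (trans (sym (χ-back (suc v) (λ e → q' (trans e ey)) e2)) (trans (χ-cong X (trans (sym (mod-suc v))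
        (trans (cong (λ t → suc t % N) q) (mod-suc (3 + u))))) b4))
    IndZ v e1 e2 | no q with suc v % N ≟ (3 + u) % N
    ...   | yes q' = true≢false (trans (sym e1) (χ-removed v (trans (suc-mod-injective {v} {2 + u} q') (sym ex)) (λ e → q
        (trans e ey))))
    ...   | no q' = ibX v (χ-back v (λ e → q (trans e ey)) e1) (χ-back (suc v) (λ e → q' (trans e ey)) e2)

    DomZ : Domχ Z
    DomZ v with v % N ≟ (2 + u) % N
    ... | yes q = ∨₃-intro₂ (χ Z v) (χ Z (suc (suc v))) (χ-added (suc v) (trans (trans (sym (mod-suc v)) (trans (cong
        (λ t → suc t % N) q) (mod-suc (2 + u)))) (sym ey)))
    ... | no q with v % N ≟ (1 + u) % N
    ...   | yes q1 = ∨₃-intro₃ (χ Z v) (χ Z (suc v)) (χ-added (suc (suc v)) (trans (trans (sym (mod-suc² v)) (trans (cong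
        (λ t → suc (suc t) % N) q1) (mod-suc² (1 + u)))) (sym ey)))
    ...   | no q1 with v % N ≟ u % N
    ...     | yes starts-in = ∨₃-intro₁ (χ Z (suc v)) (χ Z (suc (suc v))) (χ-kept v (λ e → +-mod-≢″ u 0 2 (s≤s z≤n) (s≤s (s≤s
        (s≤s z≤n))) (trans (sym starts-in) (trans e ex))) (trans (χ-cong X starts-in) b0))
    ...     | no starts-in = ∨₃-mono (χ-kept v (λ e → q (trans e ex))) (χ-kept (suc v) (λ e → q1 (suc-mod-injective {v} {1 + u}
        (trans e ex)))) (χ-kept (suc (suc v)) (λ e → starts-in (suc-mod-injective {v} {u} (suc-mod-injective {suc v} {suc u}
        (trans e ex))))) (dbX v)

    cardZ : ∣ Z ∣ ≡ ∣ X ∣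
    cardZ = ∣slide∣ X x y (trans (sym (trans (χ-def X tx) (cong (lookupℕ X) (m<n⇒m%n≡m (toℕ<n x))))) xXb)
                             (trans (sym (trans (χ-def X ty) (cong (lookupℕ X) (m<n⇒m%n≡m (toℕ<n y))))) yX)

    b5 : χ X (5 + u) ≡ true
    b5 = ∨₃-third (dbX (3 + u)) b3 b4

    cenX : Centre X (1 + u)
    cenX = trans (χ-suc+N-1 X u) b0 , b2

    cenZ : Centre Z (4 + u)
    cenZ = trans (χ-suc+N-1 Z (3 + u)) (χ-added (3 + u) (sym ey)) ,
           χ-kept (5 + u) (λ e → +-mod-≢″ u 2 3 (s≤s z≤n) (s≤s (s≤s (s≤s (s≤s z≤n)))) (sym (trans e ex))) b5

    persist : ∀ p → Centre X p → p % N ≢ (1 + u) % N → Centre Z p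
    persist p (c1 , c2) ne = χ-kept (p + N-1) n1 c1 , χ-kept (suc p) n2 c2
      where
      not3 : p % N ≢ (3 + u) % N
      not3 e = x≡true⇒x≢false (proj₂ (Centre-cong X {p} {3 + u} e (c1 , c2))) b4
      n1 : (p + N-1) % N ≢ tx
      n1 e = not3 (+N-1-mod-pred p (2 + u) (trans e ex))
      n2 : suc p % N ≢ tx
      n2 e = ne (suc-mod-injective {p} {1 + u} (trans e ex))

  module SlideLeft (X : Subset N) (ibX : Indχ X) (dbX : Domχ X) (u : ℕ)
    (b3 : χ X (3 + u) ≡ true) (b5 : χ X (5 + u) ≡ true) (b1 : χ X (1 + u) ≡ false) where

    x = fin (3 + u)
    y = fin (2 + u)
    Z = (X - x) ∪ ⁅ y ⁆
    open SlidedSet X Z x y refl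

    ex : tx ≡ (3 + u) % N
    ex = toℕ-fin (3 + u)
    ey : ty ≡ (2 + u) % N
    ey = toℕ-fin (2 + u)

    b2 : χ X (2 + u) ≡ false
    b2 = ≢true⇒false (λ e → ibX (2 + u) e b3)

    b0 : χ X u ≡ true
    b0 = ∨₃-first (dbX u) b1 b2

    xX : x ∈ X
    xX = χ⇒∈ {X} {3 + u} b3
    yX : χ X ty ≡ false
    yX = trans (χ-cong X (trans (cong (_% N) ey) (mod-idem (2 + u)))) b2
    xXb : χ X tx ≡ true
    xXb = trans (χ-cong X (trans (cong (_% N) ex) (mod-idem (3 + u)))) b3
    yX' : y ∉ X
    yX' m = true≢false (trans (sym (∈⇒χ m)) yX)
    exy : CycleE N x y
    exy = CycleE-sym (CycleE-suc (trans (cong (λ t → suc t % N) ey) (trans (mod-suc (2 + u)) (sym ex))))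

    IndZ : Indχ Z
    IndZ v e1 e2 with v % N ≟ (2 + u) % N
    ... | yes q = true≢false (trans (sym e2) (χ-removed (suc v) (trans (trans (sym (mod-suc v)) (trans (cong (λ t → suc t % N) q)
        (mod-suc (2 + u)))) (sym ex))
                         (λ e → +-mod-≢″ u 2 1 (s≤s z≤n) (s≤s (s≤s z≤n)) (sym (trans (trans (sym (mod-suc (2 + u))) (trans (cong
                             (λ t → suc t % N) (sym q)) (mod-suc v))) (trans e ey))))))
    ... | no q with suc v % N ≟ (2 + u) % N
    ...   | yes q' = true≢false (trans (sym (χ-back v (λ e → q (trans e ey)) e1)) (trans (χ-cong X
        (suc-mod-injective {v} {1 + u} q')) b1))
    ...   | no q' = ibX v (χ-back v (λ e → q (trans e ey)) e1) (χ-back (suc v) (λ e → q' (trans e ey)) e2)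

    DomZ : Domχ Z
    DomZ v with v % N ≟ (1 + u) % N
    ... | yes q = ∨₃-intro₂ (χ Z v) (χ Z (suc (suc v))) (χ-added (suc v) (trans (trans (sym (mod-suc v)) (trans (cong
        (λ t → suc t % N) q) (mod-suc (1 + u)))) (sym ey)))
    ... | no q with v % N ≟ (2 + u) % N
    ...   | yes q2 = ∨₃-intro₁ (χ Z (suc v)) (χ Z (suc (suc v))) (χ-added v (trans q2 (sym ey)))
    ...   | no q2 with v % N ≟ (3 + u) % N
    ...     | yes q3 = ∨₃-intro₃ (χ Z v) (χ Z (suc v)) (χ-kept (suc (suc v)) (λ e → +-mod-≢″ u 3 2 (s≤s z≤n) (s≤s (s≤s (s≤s z≤n)))
        (sym (trans (sym (trans (sym (mod-suc² v)) (trans (cong (λ t → suc (suc t) % N) q3) (mod-suc² (3 + u))))) (trans e ex))))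
                           (trans (χ-cong X (trans (sym (mod-suc² v)) (trans (cong (λ t → suc (suc t) % N) q3) (mod-suc²
                               (3 + u))))) b5))
    ...     | no q3 = ∨₃-mono (χ-kept v (λ e → q3 (trans e ex))) (χ-kept (suc v) (λ e → q2 (suc-mod-injective {v} {2 + u}
        (trans e ex)))) (χ-kept (suc (suc v)) (λ e → q (suc-mod-injective {v} {1 + u} (suc-mod-injective {suc v} {2 + u}
        (trans e ex))))) (dbX v)

    cardZ : ∣ Z ∣ ≡ ∣ X ∣
    cardZ = ∣slide∣ X x y (trans (sym (trans (χ-def X tx) (cong (lookupℕ X) (m<n⇒m%n≡m (toℕ<n x))))) xXb)
                             (trans (sym (trans (χ-def X ty) (cong (lookupℕ X) (m<n⇒m%n≡m (toℕ<n y))))) yX)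

    cenX : Centre X (4 + u)
    cenX = trans (χ-suc+N-1 X (3 + u)) b3 , b5

    cenZ : Centre Z (1 + u)
    cenZ = trans (χ-suc+N-1 Z u) (χ-kept u (λ e → +-mod-≢″ u 0 3 (s≤s z≤n) (s≤s (s≤s (s≤s (s≤s z≤n)))) (trans e ex)) b0) ,
           χ-added (2 + u) (sym ey)

    persist : ∀ p → Centre X p → p % N ≢ (4 + u) % N → Centre Z p
    persist p (c1 , c2) ne = χ-kept (p + N-1) n1 c1 , χ-kept (suc p) n2 c2
      where
      not2 : p % N ≢ (2 + u) % N
      not2 e = x≡true⇒x≢false (trans (sym (χ-suc+N-1 X (1 + u))) (proj₁ (Centre-cong X {p} {2 + u} e (c1 , c2)))) b1
      n1 : (p + N-1) % N ≢ tx
      n1 e = ne (+N-1-mod-pred p (3 + u) (trans e ex))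
      n2 : suc p % N ≢ tx
      n2 e = not2 (suc-mod-injective {p} {2 + u} (trans e ex))

module Cycle3k (n' k : ℕ) (hN : suc (suc (suc n')) ≡ thrice k) where

  open OnCycle n'

  every3rd-pattern : Pattern every3rd
  every3rd-pattern = record
    { starts-in = refl ; ends-out = every3rd-at-3k-1 n' k hN
    ; independent = λ o _ → every3rd-independent o ; dominating = λ o _ → every3rd-dominating o }

  optimal-every3rd : ∀ a → Optimal (place a every3rd)
  optimal-every3rd a = Optimal-place every3rd-pattern a (Σ-every3rd N)

  3⌈N/3⌉≡N : 3 * ⌈/3⌉ N ≡ N
  3⌈N/3⌉≡N = begin
    3 * ⌈/3⌉ N              ≡⟨ cong (λ m → 3 * ⌈/3⌉ m) (trans hN (sym (+-identityʳ (thrice k)))) ⟩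
    3 * ⌈/3⌉ (thrice k + 0) ≡⟨ cong (3 *_) (trans (⌈/3⌉-thrice+ k 0) (+-identityʳ k)) ⟩
    3 * k                   ≡⟨ sym (thrice≡3* k) ⟩
    thrice k                ≡⟨ sym hN ⟩
    N                       ∎
    where open ≡-Reasoning

  no-centre : ∀ X → Optimal X → ∀ c → ¬ Centre X c
  no-centre X g c ce = m+1+n≰m+n N 0 (≤-trans
    (Σ-excess₁ N (weight X) (window c) (window<N c) (λ v _ → weight≥1 X (opt-dom g) v)
               (≤-reflexive (sym (weight-window X (opt-ind g) c ce))))
    (≤-reflexive (trans (Σ-weight-optimal X g) (trans 3⌈N/3⌉≡N (sym (+-identityʳ N))))))

  weight≡1 : ∀ X → Optimal X → ∀ v → weight X v ≡ 1
  weight≡1 X g v with weight1⊎centre X (opt-ind g) (opt-dom g) v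
  ... | inj₁ e = e
  ... | inj₂ c = ⊥-elim (no-centre X g (suc v) c)

  χ-period3 : ∀ X → Optimal X → ∀ v → χ X (3 + v) ≡ χ X v
  χ-period3 X g v = sym (bit-injective _ _ (window-cancel (𝟙 X v) (𝟙 X (suc v)) (𝟙 X (suc (suc v))) (𝟙 X (3 + v))
                      (trans (weight≡1 X g v) (sym (weight≡1 X g (suc v))))))

  phase : Subset N → Fin 3
  phase X = if χ X 0 then fz else (if χ X 1 then fs fz else fs (fs fz))

  χ-phase : ∀ X → Optimal X → χ X (toℕ (phase X)) ≡ true
  χ-phase X g with χ X 0 in e0
  ... | true = e0
  ... | false with χ X 1 in e1
  ...   | true = e1
  ...   | false = ∨₃-third (opt-dom g 0) e0 e1

  ≡place-phase : ∀ X → Optimal X → X ≡ place (toℕ (phase X)) every3rd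
  ≡place-phase X g = place-unique X a every3rd (λ o p →
    χ-segment X (opt-ind g) a (χ-phase X g) N (λ o _ → weight≡1 X g (a + o)) o (≤-trans p (≤-trans (n≤1+n N) (n≤1+n (suc N)))))
    where
    a : ℕ
    a = toℕ (phase X)

  phase-place : ∀ (r : Fin 3) → phase (place (toℕ r) every3rd) ≡ r
  phase-place fz rewrite χ-place-from 0 every3rd 0 = refl
  phase-place (fs fz)
    rewrite trans (sym (χ-period3 (place 1 every3rd) (optimal-every3rd 1) 0)) (χ-place-from 1 every3rd 2)
          | χ-place-from 1 every3rd 0 = refl
  phase-place (fs (fs fz))
    rewrite trans (sym (χ-period3 (place 2 every3rd) (optimal-every3rd 2) 0)) (χ-place-from 2 every3rd 1)
          | trans (sym (χ-period3 (place 2 every3rd) (optimal-every3rd 2) 1)) (χ-place-from 2 every3rd 2) = refl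

  isISet⇒optimal : ∀ X → IsISet G X → Optimal X
  isISet⇒optimal = IsISet⇒Optimal (place 0 every3rd) (optimal-every3rd 0)

  to : ISet G → Fin 3
  to X = phase (ISet.set X)

  from : Fin 3 → ISet G
  from r = iset (place (toℕ r) every3rd) (Optimal⇒IsISet _ (optimal-every3rd _))

  from∘to : ∀ X → from (to X) ≡ X
  from∘to (iset s p) = iset-ext (recompute (≡? _ _) (sym (≡place-phase s (isISet⇒optimal s p))))

  to∘from : ∀ r → to (from r) ≡ r
  to∘from = phase-place

module Cycle3 where

  open OnCycle 0
  open Cycle3k 0 1 refl

  place≡⁅⁆ : ∀ a → place (toℕ a) every3rd ≡ ⁅ a ⁆
  place≡⁅⁆ a = lookupℕ-ext _ _ (λ v p → trans (sym (trans (χ-def (place (toℕ a) every3rd) v)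
                  (cong (lookupℕ (place (toℕ a) every3rd)) (m<n⇒m%n≡m p)))) (trans (χ-place (toℕ a) every3rd v) (pw a v p)))
    where
    pw : ∀ a v → v < 3 → every3rd ((v + offset (toℕ a)) % N) ≡ lookupℕ ⁅ a ⁆ v
    pw fz zero p = refl
    pw fz (suc zero) p = refl
    pw fz (suc (suc zero)) p = refl
    pw (fs fz) zero p = refl
    pw (fs fz) (suc zero) p = refl
    pw (fs fz) (suc (suc zero)) p = refl
    pw (fs (fs fz)) zero p = refl
    pw (fs (fs fz)) (suc zero) p = refl
    pw (fs (fs fz)) (suc (suc zero)) p = refl
    pw a (suc (suc (suc v))) (s≤s (s≤s (s≤s ())))

  slide-between-singletons : ∀ a b → a ≢ b → Slide ⁅ a ⁆ ⁅ b ⁆ a b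
  slide-between-singletons fz fz ne = ⊥-elim (ne refl)
  slide-between-singletons fz (fs fz) ne = toWitness {a? = Slide? ⁅ fz ⁆ ⁅ fs fz ⁆ fz (fs fz)} tt
  slide-between-singletons fz (fs (fs fz)) ne = toWitness {a? = Slide? ⁅ fz ⁆ ⁅ fs (fs fz) ⁆ fz (fs (fs fz))} tt
  slide-between-singletons (fs fz) fz ne = toWitness {a? = Slide? ⁅ fs fz ⁆ ⁅ fz ⁆ (fs fz) fz} tt
  slide-between-singletons (fs fz) (fs fz) ne = ⊥-elim (ne refl)
  slide-between-singletons (fs fz) (fs (fs fz)) ne = toWitness {a? = Slide? ⁅ fs fz ⁆ ⁅ fs (fs fz) ⁆ (fs fz) (fs (fs fz))} tt
  slide-between-singletons (fs (fs fz)) fz ne = toWitness {a? = Slide? ⁅ fs (fs fz) ⁆ ⁅ fz ⁆ (fs (fs fz)) fz} tt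
  slide-between-singletons (fs (fs fz)) (fs fz) ne = toWitness {a? = Slide? ⁅ fs (fs fz) ⁆ ⁅ fs fz ⁆ (fs (fs fz)) (fs fz)} tt
  slide-between-singletons (fs (fs fz)) (fs (fs fz)) ne = ⊥-elim (ne refl)

  ∈slide : ∀ (X : Subset 3) (x y : Fin 3) → y ∈ ((X - x) ∪ ⁅ y ⁆)
  ∈slide X x y = lookupℕ⇒∈ (trans (lookupℕ-∪ (X - x) ⁅ y ⁆ (toℕ y))
    (trans (cong (lookupℕ (X - x) (toℕ y) ∨_) (trans (lookupℕ-⁅⁆ y (toℕ y)) (≡ᵇ-refl (toℕ y)))) (Data.Bool.Properties.∨-zeroʳ _)))

  iso : iGraph G ≅ K3
  iso = record
    { to = to ; from = from ; from∘to = from∘to ; to∘from = to∘from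
    ; adj-to = adjTo ; adj-from = adjFrom }
    where
    adjTo : ∀ X Y → IAdj G X Y → to X ≢ to Y
    adjTo X Y (x , y , e , xm , ym , eqY) eq = ym (subst (y ∈_) (trans (sym eqY) (cong ISet.set (sym X≡Y))) (∈slide
        (ISet.set X) x y))
      where
      X≡Y : X ≡ Y
      X≡Y = trans (sym (from∘to X)) (trans (cong from eq) (from∘to Y))
    ⁅phase⁆ : ∀ X → IsISet G X → X ≡ ⁅ phase X ⁆
    ⁅phase⁆ X p = trans (≡place-phase X (isISet⇒optimal X p)) (place≡⁅⁆ (phase X))
    adjFrom : ∀ X Y → to X ≢ to Y → IAdj G X Y
    adjFrom (iset s p) (iset s' p') ne = phase s , phase s' , recompute (Slide? s s' (phase s) (phase s'))
      (subst₂ (λ S S′ → Slide S S′ (phase s) (phase s')) (sym (⁅phase⁆ s p)) (sym (⁅phase⁆ s' p')) (slide-between-singletons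
          (phase s) (phase s') ne))

module Cycle3k≥6 (m k : ℕ) (hN : suc (suc (suc (suc (suc (suc m))))) ≡ thrice k) where

  open OnCycle (suc (suc (suc m)))
  open Slides (suc (suc m))
  open Cycle3k (suc (suc (suc m))) k hN

  no-slide : ∀ X Y → Optimal X → Optimal Y → ∀ x y → ¬ Slide X Y x y
  no-slide X Y gX gY x y (e , xm , ym , eqY) = true≢false (trans (sym χYx) (χ-removed tx tx%N x≢y))
    where
    open SlidedSet X Y x y eqY
    tx%N : tx % N ≡ tx
    tx%N = m<n⇒m%n≡m (toℕ<n x)
    χXx : χ X tx ≡ true
    χXx = ∈⇒χ xm
    x≢y : tx % N ≢ ty
    x≢y e = true≢false (trans (sym χXx) (trans (χ-cong X (trans e (sym (m<n⇒m%n≡m (toℕ<n y))))) (∉⇒χ ym)))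
    3+x≢x : (3 + tx) % N ≢ tx
    3+x≢x e = +-mod-≢ tx 3 (s≤s z≤n) (s≤s (s≤s (s≤s (s≤s z≤n)))) (trans (cong (_% N) (+-comm tx 3)) (trans e (sym tx%N)))
    χYx : χ Y tx ≡ true
    χYx = trans (sym (χ-period3 Y gY tx)) (χ-kept (3 + tx) 3+x≢x (trans (χ-period3 X gX tx) χXx))

  iso : iGraph G ≅ threeK1
  iso = record
    { to = to ; from = from ; from∘to = from∘to ; to∘from = to∘from
    ; adj-to = λ { (iset s p) (iset s' p') (x , y , slide) →
                   ⊥-elim-irr (no-slide s s' (isISet⇒optimal s p) (isISet⇒optimal s' p') x y slide) }
    ; adj-from = λ _ _ () }

module Cycle3k+1 (n'' k : ℕ) (hN : suc (suc (suc (suc n''))) ≡ thrice k + 1) where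

  open OnCycle (suc n'')
  open Slides n''

  [a+2]+[b+2]≡3+[a+b]+1 : ∀ a b → (a + 2) + (b + 2) ≡ suc (suc (suc (a + b))) + 1
  [a+2]+[b+2]≡3+[a+b]+1 = solve-∀

  k>0 : 0 < k
  k>0 = positive k hN
    where
    positive : ∀ j → suc (suc (suc (suc n''))) ≡ thrice j + 1 → 0 < j
    positive zero ()
    positive (suc j) _ = s≤s z≤n

  -- For A ≡ 2 (mod 3), place (c + 1) (restartAt A) is the i-set whose centres are c and c + A.
  restartAt : ℕ → ℕ → Bool
  restartAt A = splice A every3rd every3rd

  module Restart (s s' : ℕ) (hA : N ≡ (thrice s + 2) + (thrice s' + 2)) where
    A = thrice s + 2

    N-1≡A+3s′+1 : N-1 ≡ A + (thrice s' + 1)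
    N-1≡A+3s′+1 = suc-injective (trans hA (trans (cong (A +_) (+-suc (thrice s') 1)) (+-suc A (thrice s' + 1))))

    restartAt-pattern : Pattern (restartAt A)
    restartAt-pattern = record
      { starts-in = restart-0 s
      ; ends-out = trans (cong (restartAt A) N-1≡A+3s′+1) (trans (splice-+ A every3rd every3rd (thrice s' + 1)) (every3rd-thrice+ s' 1))
      ; independent = λ o _ → restart-independent s o
      ; dominating = λ o _ → restart-dominating s o }

    Σ-restartAt : Σ< N (λ v → bit (restartAt A v)) ≡ ⌈/3⌉ N
    Σ-restartAt = trans (cong (λ m → Σ< m (λ v → bit (restartAt A v))) hA) (trans (Σ-splice A (thrice s' + 2) every3rd every3rd)
        (trans (cong₂ _+_ (trans (Σ-every3rd A) (⌈/3⌉-thrice+ s 2)) (trans (Σ-every3rd (thrice s' + 2)) (⌈/3⌉-thrice+ s' 2)))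
        (trans ([a+1]+[b+1]≡1+[a+b]+1 s s') (sym (trans (cong ⌈/3⌉ (trans hA (trans ([a+2]+[b+2]≡3+[a+b]+1 (thrice s) (thrice s'))
        (cong (λ z → suc (suc (suc z)) + 1) (sym (thrice-+ s s')))))) (⌈/3⌉-thrice+ (suc (s + s')) 1))))))
      where
      [a+1]+[b+1]≡1+[a+b]+1 : ∀ a b → (a + 1) + (b + 1) ≡ suc (a + b) + 1
      [a+1]+[b+1]≡1+[a+b]+1 = solve-∀

    optimal-restartAt : ∀ a → Optimal (place a (restartAt A))
    optimal-restartAt a = Optimal-place restartAt-pattern a Σ-restartAt

  3⌈N/3⌉≡N+2 : 3 * ⌈/3⌉ N ≡ N + 2
  3⌈N/3⌉≡N+2 = trans (cong (λ m → 3 * ⌈/3⌉ m) hN) (trans (cong (3 *_) (trans (⌈/3⌉-thrice+ k 1) (+-comm k 1))) (trans (sym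
      (thrice≡3* (suc k))) (trans (+-comm 3 (thrice k)) (trans (sym (+-assoc (thrice k) 1 2)) (cong (_+ 2) (sym hN))))))

  Σ-weight≡N+2 : ∀ X → Optimal X → Σ< N (weight X) ≡ N + 2
  Σ-weight≡N+2 X g = trans (Σ-weight-optimal X g) 3⌈N/3⌉≡N+2

  window-≢ : ∀ a b → a % N ≢ b % N → window a ≢ window b
  window-≢ a b ne e = ne (+N-1-mod-injective {a} {b} e)

  no-three-centres : ∀ X → Optimal X → ∀ a b c → a % N ≢ b % N → a % N ≢ c % N → b % N ≢ c % N → Centre X a → Centre X b → Centre X c → ⊥
  no-three-centres X g a b c nab nac nbc ca cb cc = m+1+n≰m+n N 2 (≤-trans (Σ-excess₃ N (weight X) (window a) (window b)
      (window c) (window<N a) (window<N b) (window<N c) (window-≢ a b nab) (window-≢ a c nac) (window-≢ b c nbc)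
    (λ v _ → weight≥1 X (opt-dom g) v) (≤-reflexive (sym (weight-window X (opt-ind g) a ca))) (≤-reflexive (sym (weight-window X
        (opt-ind g) b cb))) (≤-reflexive (sym (weight-window X (opt-ind g) c cc))))
    (≤-reflexive (Σ-weight≡N+2 X g)))

  centres-not-adjacent : ∀ X → Indχ X → ∀ a b → Centre X a → Centre X b → suc a % N ≡ b % N → ⊥
  centres-not-adjacent X ib a b ca cb e = true≢false (trans (sym (proj₂ ca)) (trans (χ-cong X e) (centre∉ X ib b cb)))

  <N⇒%≡ : ∀ {a} → a < N → a % N ≡ a
  <N⇒%≡ p = m<n⇒m%n≡m p

  some-centre : ∀ X → Optimal X → Σ ℕ λ c → c < N × Centre X c
  some-centre X g with search< (λ v → centre? X (suc v)) N
  ... | inj₁ (j , p , q) = (suc j) % N , m%n<n (suc j) N , Centre-mod X (suc j) (centre?⇒Centre X (suc j) q)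
  ... | inj₂ h = ⊥-elim (m+1+n≰m+n N 1 (≤-trans (≤-reflexive (sym (Σ-weight≡N+2 X g))) (≤-trans (Σ-≤1 N (weight X) le1) (≤-trans
      (n≤1+n N) (≤-reflexive (+-comm 1 N))))))
    where
    le1 : ∀ v → v < N → weight X v ≤ 1
    le1 v p with weight1⊎centre X (opt-ind g) (opt-dom g) v
    ... | inj₁ e = ≤-reflexive e
    ... | inj₂ c = ⊥-elim (true≢false (trans (sym (Centre⇒centre? X (suc v) c)) (h v p)))

  another-centre : ∀ X → Optimal X → ∀ c → c < N → Centre X c → Σ ℕ λ c' → c' < N × Centre X c' × c' ≢ c
  another-centre X g c cN cc with search< (λ v → centre? X (suc v) ∧ not ((suc v) % N ≡ᵇ c)) N
  ... | inj₁ (j , p , q) = (suc j) % N , m%n<n (suc j) N , Centre-mod X (suc j) (centre?⇒Centre X (suc j)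
      (a∧ q)) , λ e → true≢false (trans (sym (b∧ q)) (cong not (≡⇒≡ᵇtrue e)))
    where
    a∧ : ∀ {a b} → (a ∧ b) ≡ true → a ≡ true
    a∧ {true} e = refl
    b∧ : ∀ {a b} → (a ∧ b) ≡ true → b ≡ true
    b∧ {true} e = e
  ... | inj₂ h = ⊥-elim (m+1+n≰m+n N 1 (≤-trans (≤-reflexive (sym (Σ-weight≡N+2 X g))) (Σ-≤1+indicator N (weight X) (window c)
      (window<N c) le1)))
    where
    le1 : ∀ v → v < N → weight X v ≤ 1 + indicator (window c) v
    le1 v p with weight1⊎centre X (opt-ind g) (opt-dom g) v
    ... | inj₁ e = ≤-trans (≤-reflexive e) (m≤m+n 1 _)
    ... | inj₂ ce with suc v % N ≟ c
    ...   | no ne = ⊥-elim (true≢false (trans (sym (cong₂ _∧_ (Centre⇒centre? X (suc v) ce) (cong not (≢⇒≡ᵇfalse ne)))) (h v p)))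
    ...   | yes e = subst (λ z → weight X v ≤ 1 + z) (sym (trans (cong (indicator (window c)) vw) (indicator-self
        (window c)))) (weight≤2 X (opt-ind g) v)
      where
      vw : v ≡ window c
      vw = trans (sym (<N⇒%≡ p)) (trans (sym ([m+n]%n≡m%n v N)) (trans (cong (_% N) (+-suc v N-1)) (trans (sym (mod-+
          (suc v) N-1)) (cong (λ z → (z + N-1) % N) e))))

  opaque
    centre₁ : Subset N → ℕ
    centre₁ X = first (centre? X) 0 N

  opaque
    unfolding centre₁
    centre₂ : Subset N → ℕ
    centre₂ X = first (centre? X) (suc (centre₁ X)) (N ∸ suc (centre₁ X))

  opaque
    unfolding centre₂
    centre₁-spec : ∀ X → Optimal X → centre₁ X < N × Centre X (centre₁ X) × (∀ c → c < N → Centre X c → centre₁ X ≤ c)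
    centre₁-spec X g with some-centre X g
    ... | c , p , ce with first-spec (centre? X) N 0 c z≤n p (Centre⇒centre? X c ce)
    ...   | _ , le , pc = ≤-<-trans le p , centre?⇒Centre X _ pc , λ c' p' ce' → proj₁ (proj₂ (first-spec
        (centre? X) N 0 c' z≤n p' (Centre⇒centre? X c' ce')))

    centre₂-spec : ∀ X → Optimal X → centre₁ X < centre₂ X × centre₂ X < N × Centre X (centre₂ X)
    centre₂-spec X g with centre₁-spec X g
    ... | p1 , ce1 , mn with another-centre X g (centre₁ X) p1 ce1
    ...   | c' , p' , ce' , ne with first-spec (centre? X) (N ∸ suc (centre₁ X)) (suc (centre₁ X)) c' (≤∧≢⇒< (mn c' p' ce')
        (λ e → ne (sym e))) (subst (c' <_) (sym (m+[n∸m]≡n p1)) p') (Centre⇒centre? X c' ce')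
    ...     | a , b , c = a , ≤-<-trans b p' , centre?⇒Centre X _ c

  centre₁⊎centre₂ : ∀ X → Optimal X → ∀ c → c < N → Centre X c → c ≡ centre₁ X ⊎ c ≡ centre₂ X
  centre₁⊎centre₂ X g c p ce with c ≟ centre₁ X | c ≟ centre₂ X
  ... | yes e | _ = inj₁ e
  ... | no _ | yes e = inj₂ e
  ... | no n1 | no n2 = ⊥-elim (no-three-centres X g c (centre₁ X) (centre₂ X) (λ e → n1 (trans (sym (<N⇒%≡ p)) (trans e
      (<N⇒%≡ p1))))
                                  (λ e → n2 (trans (sym (<N⇒%≡ p)) (trans e (<N⇒%≡ p2))))
                                  (λ e → <-irrefl (trans (sym (<N⇒%≡ p1)) (trans e (<N⇒%≡ p2))) lt12)
                                  ce ce1 ce2)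
    where
    p1 = proj₁ (centre₁-spec X g)
    ce1 = proj₁ (proj₂ (centre₁-spec X g))
    lt12 = proj₁ (centre₂-spec X g)
    p2 = proj₁ (proj₂ (centre₂-spec X g))
    ce2 = proj₂ (proj₂ (centre₂-spec X g))

  ≥2 : ∀ {a} → a ≢ 0 → a ≢ 1 → Σ ℕ λ b → a ≡ suc (suc b)
  ≥2 {zero} n0 n1 = ⊥-elim (n0 refl)
  ≥2 {suc zero} n0 n1 = ⊥-elim (n1 refl)
  ≥2 {suc (suc b)} n0 n1 = b , refl

  centre-gap≥2 : ∀ X → Optimal X → ∀ c c' → c < c' → Centre X c → Centre X c' → Σ ℕ λ L → c' ∸ c ≡ suc (suc L)
  centre-gap≥2 X g c c' lt cc cc' = ≥2 {c' ∸ c}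
    (λ e → <-irrefl refl (subst (c <_) (trans (sym cA) (trans (cong (c +_) e) (+-identityʳ c))) lt))
    (λ e → centres-not-adjacent X (opt-ind g) c c' cc cc'
             (cong (_% N) (trans (sym (+-identityʳ (suc c))) (trans (sym (+-suc c 0)) (trans (cong (c +_) (sym e)) cA)))))
    where
    cA : c + (c' ∸ c) ≡ c'
    cA = m+[n∸m]≡n (<⇒≤ lt)

  ≡place-centres : ∀ X → Optimal X → ∀ c c' → c < c' → c' < N → Centre X c → Centre X c' → X ≡ place (suc c) (restartAt (c' ∸ c))
  ≡place-centres X g c c' lt c'N cc cc' = place-unique X (suc c) (restartAt A) h
    where
    ib = opt-ind g
    A = c' ∸ c
    cA : c + A ≡ c'
    cA = m+[n∸m]≡n (<⇒≤ lt)
    AN : A < N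
    AN = ≤-<-trans (m∸n≤m c' c) c'N
    A2 = centre-gap≥2 X g c c' lt cc cc'
    L1 = proj₁ A2
    AL : A ≡ suc (suc L1)
    AL = proj₂ A2
    R = N ∸ A
    AR : A + R ≡ N
    AR = m+[n∸m]≡n (<⇒≤ AN)
    R2 = ≥2 {R} (λ e → <-irrefl (trans (sym (+-identityʳ A)) (trans (cong (A +_) (sym e)) AR)) AN)
                 (λ e → centres-not-adjacent X ib c' c cc' cc (trans (cong (_% N) (trans (sym (+-comm c' 1)) (trans (cong (_+ 1)
                     (sym cA)) (trans (+-assoc c A 1) (cong (c +_) (trans (cong (A +_) (sym e)) AR)))))) ([m+n]%n≡m%n c N)))
    L2 = proj₁ R2
    RL : R ≡ suc (suc L2)
    RL = proj₂ R2
    noc : ∀ t → t % N ≢ c % N → t % N ≢ c' % N → ¬ Centre X t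
    noc t n1 n2 ct = no-three-centres X g t c c' n1 n2 (λ e → <-irrefl (trans (sym (<N⇒%≡ (<-trans lt c'N))) (trans e
        (<N⇒%≡ c'N))) lt) ct cc cc'
    seg1 : ∀ o → o < A → χ X (suc c + o) ≡ every3rd o
    seg1 o p = χ-from-centre X g c L1 cc none o (subst (o <_) AL p)
      where
      none : ∀ o → o < L1 → ¬ Centre X (suc (suc c + o))
      none o p = noc (suc (suc c + o)) n1 n2
        where
        eqt : suc (suc c + o) ≡ c + suc (suc o)
        eqt = sym (trans (+-suc c (suc o)) (cong suc (+-suc c o)))
        o2A : suc (suc o) < A
        o2A = subst (suc (suc o) <_) (sym AL) (s≤s (s≤s p))
        n1 : suc (suc c + o) % N ≢ c % N
        n1 e = +-mod-≢ c (suc (suc o)) (s≤s z≤n) (<-trans o2A AN) (trans (cong (_% N) (sym eqt)) e)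
        n2 : suc (suc c + o) % N ≢ c' % N
        n2 e = +-mod-≢′ c (suc (suc o)) A o2A (subst (A <_) (+-comm N (suc (suc o))) (≤-trans AN (m≤m+n N _)))
                 (trans (cong (_% N) (trans (+-comm (suc (suc o)) c) (sym eqt))) (trans e (cong (_% N) (trans (sym cA)
                     (+-comm c A)))))
    seg2 : ∀ o → o < R → χ X (suc c' + o) ≡ every3rd o
    seg2 o p = χ-from-centre X g c' L2 cc' none o (subst (o <_) RL p)
      where
      none : ∀ o → o < L2 → ¬ Centre X (suc (suc c' + o))
      none o p = noc (suc (suc c' + o)) n1 n2
        where
        eqt : suc (suc c' + o) ≡ c' + suc (suc o)
        eqt = sym (trans (+-suc c' (suc o)) (cong suc (+-suc c' o)))
        o2R : suc (suc o) < R
        o2R = subst (suc (suc o) <_) (sym RL) (s≤s (s≤s p))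
        lt2 : A + suc (suc o) < N
        lt2 = subst (A + suc (suc o) <_) AR (+-monoʳ-< A o2R)
        n2 : suc (suc c' + o) % N ≢ c' % N
        n2 e = +-mod-≢ c' (suc (suc o)) (s≤s z≤n) (≤-<-trans (m≤n+m (suc (suc o)) A) lt2) (trans (cong (_% N) (sym eqt)) e)
        n1 : suc (suc c' + o) % N ≢ c % N
        n1 e = +-mod-≢ c (A + suc (suc o)) (≤-<-trans z≤n (+-monoʳ-< A (s≤s z≤n))) lt2 (trans (cong (_% N) (trans (sym
            (+-assoc c A (suc (suc o)))) (trans (cong (_+ suc (suc o)) cA) (sym eqt)))) e)
    h : ∀ o → o < N → χ X (suc c + o) ≡ restartAt A o
    h o p with o <? A
    ... | yes q = trans (seg1 o q) (sym (splice-< A every3rd every3rd o q))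
    ... | no q = trans (cong (χ X) eq1) (trans (seg2 (o ∸ A) (+-cancelˡ-< A (o ∸ A) R (subst₂ _<_ (sym (m+[n∸m]≡n le))
        (sym AR) p))) (sym (trans (cong (restartAt A) (sym (m+[n∸m]≡n le))) (splice-+ A every3rd every3rd (o ∸ A)))))
      where
      le : A ≤ o
      le = ≮⇒≥ q
      eq1 : suc c + o ≡ suc c' + (o ∸ A)
      eq1 = cong suc (trans (cong (c +_) (sym (m+[n∸m]≡n le))) (trans (sym (+-assoc c A (o ∸ A))) (cong (_+ (o ∸ A)) cA)))

  1+3k≡N : suc (3 * k) ≡ N
  1+3k≡N = sym (trans hN (trans (cong (_+ 1) (thrice≡3* k)) (+-comm (3 * k) 1)))

  %-cong-divisor : ∀ {d} .{{_ : NonZero d}} → d ≡ N → ∀ x → x % d ≡ x % N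
  %-cong-divisor refl x = refl

  %1+3k≡%N : ∀ x → x % suc (3 * k) ≡ x % N
  %1+3k≡%N = %-cong-divisor 1+3k≡N

  %-range : ∀ x → N ≤ x → x < N + N → x % N ≡ x ∸ N
  %-range x p q = trans (cong (_% N) (sym (m∸n+n≡m p))) (trans ([m+n]%n≡m%n (x ∸ N) N) (<N⇒%≡ (+-cancelʳ-< N (x ∸ N) N (subst
      (_< N + N) (sym (m∸n+n≡m p)) q))))

  BraceletCond : ℕ → ℕ → Set
  BraceletCond l h = ∃[ s ] (s < k × (l + 3 * s + 2) % suc (3 * k) ≡ h ⊎ s < k × (h + 3 * s + 2) % suc (3 * k) ≡ l)

  split-N : ∀ s → s < k → Σ ℕ λ s' → N ≡ (thrice s + 2) + (thrice s' + 2)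
  split-N s p = k ∸ suc s , trans hN (trans (cong (λ z → thrice z + 1) (sym (m+[n∸m]≡n p))) (trans (cong (λ z → suc (suc
      (suc z)) + 1) (thrice-+ s (k ∸ suc s))) (sym ([a+2]+[b+2]≡3+[a+b]+1 (thrice s) (thrice (k ∸ suc s))))))

  +3s+2≡+thrice : ∀ x s → x + 3 * s + 2 ≡ x + (thrice s + 2)
  +3s+2≡+thrice x s = trans (+-assoc x (3 * s) 2) (cong (λ z → x + (z + 2)) (sym (thrice≡3* s)))

  BraceletCond⇒gap : ∀ l h → l < h → h < N → BraceletCond l h → Σ ℕ λ a → Σ ℕ λ b → h ∸ l ≡ thrice a + 2 × N ≡ (thrice a + 2) +
      (thrice b + 2)
  BraceletCond⇒gap l h lh hN' (s , inj₁ (sk , e)) with split-N s sk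
  ... | s' , eN with (l + (thrice s + 2)) <? N
  ...   | yes lt = s , s' , trans (cong (_∸ l) (sym e2)) (m+n∸m≡n l (thrice s + 2)) , eN
    where
    e2 : l + (thrice s + 2) ≡ h
    e2 = trans (sym (<N⇒%≡ lt)) (trans (cong (_% N) (sym (+3s+2≡+thrice l s))) (trans (sym (%1+3k≡%N (l + 3 * s + 2))) e))
  ...   | no ge = ⊥-elim (<-irrefl refl (<-trans lh (subst (_< l) e2 bad)))
    where
    DN : thrice s + 2 < N
    DN = subst (thrice s + 2 <_) (sym eN) (m<m+n (thrice s + 2) (subst (0 <_) (sym (+-suc (thrice s') 1)) (s≤s z≤n)))
    e2 : l + (thrice s + 2) ∸ N ≡ h
    e2 = trans (sym (%-range _ (≮⇒≥ ge) (+-mono-< (<-trans lh hN') DN))) (trans (cong (_% N) (sym (+3s+2≡+thrice l s))) (trans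
        (sym (%1+3k≡%N (l + 3 * s + 2))) e))
    bad : l + (thrice s + 2) ∸ N < l
    bad = +-cancelʳ-< N _ l (subst (_< l + N) (sym (m∸n+n≡m (≮⇒≥ ge))) (+-monoʳ-< l DN))
  BraceletCond⇒gap l h lh hN' (s , inj₂ (sk , e)) with split-N s sk
  ... | s' , eN with (h + (thrice s + 2)) <? N
  ...   | yes lt = ⊥-elim (<-irrefl refl (<-trans lh (subst (h <_) e2 (subst (h <_) (+-comm (thrice s + 2) h) (m<n+m h (subst
      (0 <_) (sym (+-suc (thrice s) 1)) (s≤s z≤n)))))))
    where
    e2 : h + (thrice s + 2) ≡ l
    e2 = trans (sym (<N⇒%≡ lt)) (trans (cong (_% N) (sym (+3s+2≡+thrice h s))) (trans (sym (%1+3k≡%N (h + 3 * s + 2))) e))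
  ...   | no ge = s' , s , hl , trans eN (+-comm (thrice s + 2) (thrice s' + 2))
    where
    DN : thrice s + 2 < N
    DN = subst (thrice s + 2 <_) (sym eN) (m<m+n (thrice s + 2) (subst (0 <_) (sym (+-suc (thrice s') 1)) (s≤s z≤n)))
    e2 : h + (thrice s + 2) ∸ N ≡ l
    e2 = trans (sym (%-range _ (≮⇒≥ ge) (+-mono-< hN' DN))) (trans (cong (_% N) (sym (+3s+2≡+thrice h s))) (trans (sym (%1+3k≡%N
        (h + 3 * s + 2))) e))
    hD : l + N ≡ h + (thrice s + 2)
    hD = trans (cong (_+ N) (sym e2)) (m∸n+n≡m (≮⇒≥ ge))
    lE : l + (thrice s' + 2) ≡ h
    lE = +-cancelʳ-≡ (thrice s + 2) _ _ (trans (+-assoc l (thrice s' + 2) (thrice s + 2)) (trans (cong (l +_) (trans (+-comm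
        (thrice s' + 2) (thrice s + 2)) (sym eN))) hD))
    hl : h ∸ l ≡ thrice s' + 2
    hl = trans (cong (_∸ l) (sym lE)) (m+n∸m≡n l (thrice s' + 2))

  centre-gap : ∀ X → Optimal X → ∀ c1 c2 → c1 < c2 → c2 < N → Centre X c1 → Centre X c2 → Σ ℕ λ s0 → s0 < k × c1 +
      (thrice s0 + 2) ≡ c2
  centre-gap X g c1 c2 lt c2N ce1 ce2 = s0 , s0k , trans (cong (c1 +_) (sym AL')) cA
    where
    A = c2 ∸ c1
    cA : c1 + A ≡ c2
    cA = m+[n∸m]≡n (<⇒≤ lt)
    A2 = centre-gap≥2 X g c1 c2 lt ce1 ce2
    L1 = proj₁ A2
    AL : A ≡ suc (suc L1)
    AL = proj₂ A2
    eqX = ≡place-centres X g c1 c2 lt c2N ce1 ce2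
    L1A : L1 < A
    L1A = subst (L1 <_) (sym AL) (n≤1+n (suc L1))
    bL : χ X (suc c1 + L1) ≡ true
    bL = trans (sym (χ-periodic X (suc c1 + L1))) (trans (cong (χ X) ar) (proj₁ ce2))
      where
      reindex : ∀ c L n → suc c + L + suc (suc (suc (suc n))) ≡ c + suc (suc L) + suc (suc (suc n))
      reindex = solve-∀
      ar : suc c1 + L1 + N ≡ c2 + N-1
      ar = trans (reindex c1 L1 n'') (cong (_+ N-1) (trans (cong (c1 +_) (sym AL)) cA))
    pL : every3rd L1 ≡ true
    pL = trans (sym (splice-< A every3rd every3rd L1 L1A)) (trans (cong (restartAt A) (sym (<N⇒%≡ (<-trans L1A (≤-<-trans
        (m∸n≤m c2 c1) c2N))))) (trans (sym (χ-place-from (suc c1) (restartAt A) L1)) (trans (cong (λ Z → χ Z (suc c1 + L1)) (sym eqX)) bL)))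
    s0 = proj₁ (every3rd⇒thrice L1 pL)
    AL' : A ≡ thrice s0 + 2
    AL' = trans AL (trans (cong (λ z → suc (suc z)) (proj₂ (every3rd⇒thrice L1 pL))) (sym (+-comm (thrice s0) 2)))
    s0k : s0 < k
    h1 : thrice s0 + 2 < thrice k + 1
    h1 = subst (thrice s0 + 2 <_) hN (≤-<-trans (≤-trans (≤-reflexive (sym AL')) (m∸n≤m c2 c1)) c2N)
    h2 : thrice s0 < thrice k
    h2 = <-≤-trans (m<m+n (thrice s0) (s≤s z≤n)) (≤-pred (subst (suc (thrice s0 + 2) ≤_) (+-comm (thrice k) 1) h1))
    s0k = *-cancelˡ-< 3 s0 k (subst₂ _<_ (thrice≡3* s0) (thrice≡3* k) h2)

  two-centres-determine : ∀ X Y → Optimal X → Optimal Y → ∀ a b → a < b → b < N → Centre X a → Centre X b → Centre Y a → Centre Y b → X ≡ Y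
  two-centres-determine X Y gX gY a b lt bN xa xb ya yb = trans (≡place-centres X gX a b lt bN xa xb) (sym
      (≡place-centres Y gY a b lt bN ya yb))

  centres-of-place : ∀ l a b → N ≡ (thrice a + 2) + (thrice b + 2) →
             Centre (place (suc l) (restartAt (thrice a + 2))) l × Centre (place (suc l) (restartAt (thrice a + 2))) (l +
                 (thrice a + 2))
  centres-of-place l a b eN = (cc1 , cc2) , (cc3 , cc4)
    where
    reindex : ∀ l ta n → l + (ta + 2) + suc (suc (suc n)) ≡ (suc l + ta) + suc (suc (suc (suc n)))
    reindex = solve-∀
    A = thrice a + 2
    C = place (suc l) (restartAt A)
    m2 : suc (suc n'') ≡ A + thrice b
    m2 = suc-injective (suc-injective (trans eN (trans (cong (A +_) (trans (+-suc (thrice b) 1) (cong suc (+-suc (thrice b) 0))))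
        (trans (+-suc A (suc (thrice b + 0))) (cong suc (trans (+-suc A (thrice b + 0)) (cong (λ z → suc (A + z)) (+-identityʳ
        (thrice b)))))))))
    m2N : suc (suc n'') < N
    m2N = s≤s (s≤s (s≤s (n≤1+n n'')))
    A0 : 0 < A
    A0 = subst (0 <_) (sym (+-suc (thrice a) 1)) (s≤s z≤n)
    taA : thrice a < A
    taA = m<m+n (thrice a) (s≤s z≤n)
    AN : A < N
    AN = subst (A <_) (sym eN) (m<m+n A (subst (0 <_) (sym (+-suc (thrice b) 1)) (s≤s z≤n)))
    cc1 : χ C (l + N-1) ≡ true
    cc1 = trans (cong (χ C) (+-suc l (suc (suc n'')))) (trans (χ-place-from (suc l) (restartAt A) (suc (suc n''))) (trans (cong
        (restartAt A) (trans (<N⇒%≡ m2N) m2)) (trans (splice-+ A every3rd every3rd (thrice b)) (trans (cong every3rd (sym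
        (+-identityʳ (thrice b)))) (every3rd-thrice+ b 0)))))
    cc2 : χ C (suc l) ≡ true
    cc2 = trans (cong (χ C) (sym (+-identityʳ (suc l)))) (trans (χ-place-from (suc l) (restartAt A) 0)
        (splice-< A every3rd every3rd 0 A0))
    cc3 : χ C (l + A + N-1) ≡ true
    cc3 = trans (cong (χ C) (reindex l (thrice a) n'')) (trans (χ-periodic C (suc l + thrice a)) (trans (χ-place-from (suc l)
        (restartAt A) (thrice a)) (trans (cong (restartAt A) (<N⇒%≡ (<-trans taA AN))) (trans (splice-< A every3rd every3rd
        (thrice a) taA) (trans (cong every3rd (sym (+-identityʳ (thrice a)))) (every3rd-thrice+ a 0))))))
    cc4 : χ C (suc (l + A)) ≡ true
    cc4 = trans (χ-place-from (suc l) (restartAt A) A) (trans (cong (restartAt A) (trans (<N⇒%≡ AN) (sym (+-identityʳ A))))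
        (splice-+ A every3rd every3rd 0))

  centres-unique : ∀ X → Optimal X → ∀ l h → l < h → h < N → Centre X l → Centre X h → centre₁ X ≡ l × centre₂ X ≡ h
  centres-unique X g l h lh hN' cl ch with centre₁⊎centre₂ X g l (<-trans lh hN') cl | centre₁⊎centre₂ X g h hN' ch
  ... | inj₁ e1 | inj₂ e2 = sym e1 , sym e2
  ... | inj₁ e1 | inj₁ e2 = ⊥-elim (<-irrefl (trans e1 (sym e2)) lh)
  ... | inj₂ e1 | inj₂ e2 = ⊥-elim (<-irrefl (trans e1 (sym e2)) lh)
  ... | inj₂ e1 | inj₁ e2 = ⊥-elim (<-asym lh (subst₂ _<_ (sym e2) (sym e1) (proj₁ (centre₂-spec X g))))

  BraceletCond-centres : ∀ X → Optimal X → BraceletCond (centre₁ X) (centre₂ X)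
  BraceletCond-centres X g = proj₁ r , inj₁ (proj₁ (proj₂ r) , trans (%1+3k≡%N (centre₁ X + 3 * proj₁ r + 2)) (trans (cong (_% N)
      (trans (+3s+2≡+thrice (centre₁ X) (proj₁ r)) (proj₂ (proj₂ r)))) (<N⇒%≡ (proj₁ (proj₂ (centre₂-spec X g))))))
    where
    r = centre-gap X g (centre₁ X) (centre₂ X) (proj₁ (centre₂-spec X g)) (proj₁ (proj₂ (centre₂-spec X g))) (proj₁ (proj₂
        (centre₁-spec X g))) (proj₂ (proj₂ (centre₂-spec X g)))

  place-isISet : ∀ l h → l < h → h < suc (3 * k) → BraceletCond l h → IsISet G (place (suc l) (restartAt (h ∸ l)))
  place-isISet l h lh hm c with BraceletCond⇒gap l h lh (subst (h <_) 1+3k≡N hm) c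
  ... | a , b , eA , eN = subst (λ A → IsISet G (place (suc l) (restartAt A))) (sym eA) (Optimal⇒IsISet _
      (Restart.optimal-restartAt a b eN (suc l)))

  place-optimal : ∀ l h → l < h → h < suc (3 * k) → BraceletCond l h → Optimal (place (suc l) (restartAt (h ∸ l)))
  place-optimal l h lh hm c with BraceletCond⇒gap l h lh (subst (h <_) 1+3k≡N hm) c
  ... | a , b , eA , eN = subst (λ A → Optimal (place (suc l) (restartAt A))) (sym eA) (Restart.optimal-restartAt a b eN (suc l))

  place-centres : ∀ l h → l < h → h < suc (3 * k) → BraceletCond l h → Centre (place (suc l) (restartAt
      (h ∸ l))) l × Centre (place (suc l) (restartAt (h ∸ l))) h
  place-centres l h lh hm c with BraceletCond⇒gap l h lh (subst (h <_) 1+3k≡N hm) c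
  ... | a , b , eA , eN = subst (λ A → Centre (place (suc l) (restartAt A)) l × Centre (place (suc l) (restartAt A)) h) (sym eA)
                            (proj₁ cc , subst (Centre (place (suc l) (restartAt (thrice a + 2)))) (trans (cong (l +_) (sym eA))
                                (m+[n∸m]≡n (<⇒≤ lh))) (proj₂ cc))
    where cc = centres-of-place l a b eN

  isISet⇒optimal : ∀ X → IsISet G X → Optimal X
  isISet⇒optimal X p = IsISet⇒Optimal (place 0 (restartAt 2)) good0 X p
    where
    good0 : Optimal (place 0 (restartAt 2))
    good0 = Restart.optimal-restartAt 0 (proj₁ (split-N 0 k>0)) (proj₂ (split-N 0 k>0)) 0

  to : ISet G → BVertex k
  to (iset s p) = bv (centre₁ s) (centre₂ s) (proj₁ (centre₂-spec s (isISet⇒optimal s p))) (subst (centre₂ s <_) (sym 1+3k≡N)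
      (proj₁ (proj₂ (centre₂-spec s (isISet⇒optimal s p))))) (BraceletCond-centres s (isISet⇒optimal s p))

  from : BVertex k → ISet G
  from (bv l h lh hm c) = iset (place (suc l) (restartAt (h ∸ l))) (place-isISet l h lh hm c)

  BVertex-ext : ∀ {u v : BVertex k} → BVertex.lo u ≡ BVertex.lo v → BVertex.hi u ≡ BVertex.hi v → u ≡ v
  BVertex-ext {bv l h _ _ _} {bv .l .h _ _ _} refl refl = refl

  from∘to : ∀ X → from (to X) ≡ X
  from∘to (iset s p) = iset-ext (recompute (≡? _ _) (sym (ch s (isISet⇒optimal s p))))
    where
    ch : ∀ s → Optimal s → s ≡ place (suc (centre₁ s)) (restartAt (centre₂ s ∸ centre₁ s))
    ch s g = ≡place-centres s g (centre₁ s) (centre₂ s) (proj₁ (centre₂-spec s g)) (proj₁ (proj₂ (centre₂-spec s g))) (proj₁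
        (proj₂ (centre₁-spec s g))) (proj₂ (proj₂ (centre₂-spec s g)))

  centres-place : ∀ l h → l < h → h < suc (3 * k) → BraceletCond l h → centre₁ (place (suc l) (restartAt
      (h ∸ l))) ≡ l × centre₂ (place (suc l) (restartAt (h ∸ l))) ≡ h
  centres-place l h lh hm c = centres-unique (place (suc l) (restartAt (h ∸ l))) (place-optimal l h lh hm c) l h lh (subst
      (h <_) 1+3k≡N hm) (proj₁ (place-centres l h lh hm c)) (proj₂ (place-centres l h lh hm c))

  to∘from : ∀ v → to (from v) ≡ v
  to∘from (bv l h lh hm c) = BVertex-ext (recompute (_ ≟ _) (proj₁ (centres-place l h lh hm c))) (recompute (_ ≟ _) (proj₂
      (centres-place l h lh hm c)))

  IsPairℕ : ℕ → ℕ → ℕ → ℕ → Set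
  IsPairℕ l h a b = (l ≡ a × h ≡ b) ⊎ (l ≡ b × h ≡ a)

  centres-pair : ∀ X → Optimal X → ∀ a b → a < N → b < N → a ≢ b → Centre X a → Centre X b → IsPairℕ (centre₁ X) (centre₂ X) a b
  centres-pair X g a b aN bN ne ca cb with centre₁⊎centre₂ X g a aN ca | centre₁⊎centre₂ X g b bN cb
  ... | inj₁ e1 | inj₂ e2 = inj₁ (sym e1 , sym e2)
  ... | inj₂ e1 | inj₁ e2 = inj₂ (sym e2 , sym e1)
  ... | inj₁ e1 | inj₁ e2 = ⊥-elim (ne (trans e1 (sym e2)))
  ... | inj₂ e1 | inj₂ e2 = ⊥-elim (ne (trans e1 (sym e2)))

  other-centre : Subset N → ℕ → ℕ
  other-centre X c = if centre₁ X ≡ᵇ c then centre₂ X else centre₁ X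

  other-centre-spec : ∀ X → Optimal X → ∀ c → other-centre X c < N × Centre X (other-centre X c) × other-centre X c ≢ c
  other-centre-spec X g c with centre₁ X ≡ᵇ c in eq
  ... | true = proj₁ (proj₂ (centre₂-spec X g)) , proj₂ (proj₂ (centre₂-spec X g)) , λ e → <-irrefl (trans (≡ᵇ⇒≡ _ _ (subst T
      (sym eq) tt)) (sym e)) (proj₁ (centre₂-spec X g))
  ... | false = proj₁ (centre₁-spec X g) , proj₁ (proj₂ (centre₁-spec X g)) , λ e → true≢false (trans (sym (≡⇒≡ᵇtrue e)) eq)

  BAdjℕ : ℕ → ℕ → ℕ → ℕ → ℕ → ℕ → ℕ → Set
  BAdjℕ l h l' h' a b c = IsPairℕ l h a b × IsPairℕ l' h' a c × ((b + 3) % suc (3 * k) ≡ c ⊎ (c + 3) % suc (3 * k) ≡ b)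

  BAdjℕ? : ∀ l h l' h' a b c → Dec (BAdjℕ l h l' h' a b c)
  BAdjℕ? l h l' h' a b c = dP l h a b ×-dec (dP l' h' a c ×-dec (((b + 3) % suc (3 * k) ≟ c) ⊎-dec ((c + 3) % suc (3 * k) ≟ b)))
    where
    dP : ∀ l h a b → Dec (IsPairℕ l h a b)
    dP l h a b = ((l ≟ a) ×-dec (h ≟ b)) ⊎-dec ((l ≟ b) ×-dec (h ≟ a))

  right-slide⇒BAdj : ∀ X Y → Optimal X → Optimal Y → (x y : Fin N) → (e : CycleE N x y) → x ∈ X → y ∉ X → (eqY : Y ≡
      (X - x) ∪ ⁅ y ⁆) →
           (d : suc (toℕ x) % N ≡ toℕ y) →
           BAdjℕ (centre₁ X) (centre₂ X) (centre₁ Y) (centre₂ Y) (other-centre X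
               ((toℕ x + N-1) % N)) ((toℕ x + N-1) % N) ((toℕ x + 2) % N)
  right-slide⇒BAdj X Y gX gY x y e xm ym eqY d = centres-pair X gX p cXr pN (m%n<n (toℕ x + N-1) N) pne pc cXc ,
                                       centres-pair Y gY p cYr pN (m%n<n (toℕ x + 2) N) pnY (CentreShift.persist r p pc pcx) cYc ,
                                       inj₁ (trans (%1+3k≡%N (cXr + 3)) (trans (mod-+ (toℕ x + N-1) 3) (trans (cong (_% N)
                                           (reindex-shift (toℕ x) n'')) ([m+n]%n≡m%n (toℕ x + 2) N))))
    where
    reindex-centre : ∀ t n → suc (suc (suc (suc (t + suc (suc n))))) ≡ (t + 2) + suc (suc (suc (suc n)))
    reindex-centre = solve-∀
    reindex-shift : ∀ t n → t + suc (suc (suc n)) + 3 ≡ (t + 2) + suc (suc (suc (suc n)))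
    reindex-shift = solve-∀
    tx = toℕ x
    r = SlideCentres.Plus.res X Y x y eqY (opt-ind gX) (opt-dom gX) (opt-ind gY) (opt-dom gY) (∈⇒χ xm) (∉⇒χ ym) d
    cXr = (tx + N-1) % N
    cYr = (tx + 2) % N
    p = other-centre X cXr
    pN = proj₁ (other-centre-spec X gX cXr)
    pc = proj₁ (proj₂ (other-centre-spec X gX cXr))
    pne = proj₂ (proj₂ (other-centre-spec X gX cXr))
    eX : CentreShift.cX r % N ≡ cXr % N
    eX = trans (cong (_% N) (sym (+-suc tx (suc (suc n''))))) (sym (mod-idem (tx + N-1)))
    eY : CentreShift.cY r % N ≡ cYr % N
    eY = trans (cong (_% N) (reindex-centre tx n'')) (trans ([m+n]%n≡m%n (tx + 2) N) (sym (mod-idem (tx + 2))))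
    cXc : Centre X cXr
    cXc = Centre-cong X {CentreShift.cX r} {cXr} eX (CentreShift.cenX r)
    cYc : Centre Y cYr
    cYc = Centre-cong Y {CentreShift.cY r} {cYr} eY (CentreShift.cenY r)
    pcx : p % N ≢ CentreShift.cX r % N
    pcx q = pne (trans (sym (<N⇒%≡ pN)) (trans q (trans eX (mod-idem (tx + N-1)))))
    pnY : p ≢ cYr
    pnY q = CentreShift.notCenX r (Centre-cong X {p} {CentreShift.cY r} (trans (cong (_% N) q) (sym eY)) pc)

  left-slide⇒BAdj : ∀ X Y → Optimal X → Optimal Y → (x y : Fin N) → (e : CycleE N x y) → x ∈ X → y ∉ X → (eqY : Y ≡
      (X - x) ∪ ⁅ y ⁆) →
            (d : suc (toℕ y) % N ≡ toℕ x) →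
            BAdjℕ (centre₁ X) (centre₂ X) (centre₁ Y) (centre₂ Y) (other-centre X
                ((toℕ x + 1) % N)) ((toℕ x + 1) % N) ((toℕ x + suc (suc n'')) % N)
  left-slide⇒BAdj X Y gX gY x y e xm ym eqY d = centres-pair X gX p cXr pN (m%n<n (toℕ x + 1) N) pne pc cXc ,
                                        centres-pair Y gY p cYr pN (m%n<n (toℕ x + suc
                                            (suc n'')) N) pnY (CentreShift.persist r p pc pcx) cYc ,
                                        inj₂ (trans (%1+3k≡%N (cYr + 3)) (trans (mod-+ (tx + suc (suc n'')) 3) (trans (cong (_% N)
                                            (reindex-shift tx n'')) ([m+n]%n≡m%n (tx + 1) N))))
    where
    reindex-centre : ∀ t n → suc (suc (suc (suc (t + suc n)))) ≡ (t + 1) + suc (suc (suc (suc n)))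
    reindex-centre = solve-∀
    reindex-shift : ∀ t n → t + suc (suc n) + 3 ≡ (t + 1) + suc (suc (suc (suc n)))
    reindex-shift = solve-∀
    tx = toℕ x
    r = SlideCentres.Minus.res X Y x y eqY (opt-ind gX) (opt-dom gX) (opt-ind gY) (opt-dom gY) (∈⇒χ xm) (∉⇒χ ym) d
    cXr = (tx + 1) % N
    cYr = (tx + suc (suc n'')) % N
    p = other-centre X cXr
    pN = proj₁ (other-centre-spec X gX cXr)
    pc = proj₁ (proj₂ (other-centre-spec X gX cXr))
    pne = proj₂ (proj₂ (other-centre-spec X gX cXr))
    eX : CentreShift.cX r % N ≡ cXr % N
    eX = trans (cong (_% N) (reindex-centre tx n'')) (trans ([m+n]%n≡m%n (tx + 1) N) (sym (mod-idem (tx + 1))))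
    eY : CentreShift.cY r % N ≡ cYr % N
    eY = trans (cong (_% N) (sym (+-suc tx (suc n'')))) (sym (mod-idem (tx + suc (suc n''))))
    cXc : Centre X cXr
    cXc = Centre-cong X {CentreShift.cX r} {cXr} eX (CentreShift.cenX r)
    cYc : Centre Y cYr
    cYc = Centre-cong Y {CentreShift.cY r} {cYr} eY (CentreShift.cenY r)
    pcx : p % N ≢ CentreShift.cX r % N
    pcx q = pne (trans (sym (<N⇒%≡ pN)) (trans q (trans eX (mod-idem (tx + 1)))))
    pnY : p ≢ cYr
    pnY q = CentreShift.notCenX r (Centre-cong X {p} {CentreShift.cY r} (trans (cong (_% N) q) (sym eY)) pc)

  record DistinctCentres (X : Subset N) (a b : ℕ) : Set where
    field
      a<N : a < N
      b<N : b < N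
      a≢b : a ≢ b
      centre-a : Centre X a
      centre-b : Centre X b

  pair-centres : ∀ X → Optimal X → ∀ a b → IsPairℕ (centre₁ X) (centre₂ X) a b → DistinctCentres X a b
  pair-centres X g a b (inj₁ (refl , refl)) = record
    { a<N = proj₁ (centre₁-spec X g) ; b<N = proj₁ (proj₂ (centre₂-spec X g))
    ; a≢b = λ e → <-irrefl e (proj₁ (centre₂-spec X g))
    ; centre-a = proj₁ (proj₂ (centre₁-spec X g)) ; centre-b = proj₂ (proj₂ (centre₂-spec X g)) }
  pair-centres X g a b (inj₂ (refl , refl)) = record
    { a<N = proj₁ (proj₂ (centre₂-spec X g)) ; b<N = proj₁ (centre₁-spec X g)
    ; a≢b = λ e → <-irrefl (sym e) (proj₁ (centre₂-spec X g))
    ; centre-a = proj₂ (proj₂ (centre₂-spec X g)) ; centre-b = proj₁ (proj₂ (centre₁-spec X g)) }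

  centres-determine : ∀ Y Z → Optimal Y → Optimal Z → ∀ a c → a < N → c < N → a ≢ c → Centre Y a → Centre Y c → Centre Z a → Centre Z c → Y ≡ Z
  centres-determine Y Z gY gZ a c aN cN ne ya yc za zc with <-cmp a c
  ... | tri< lt _ _ = two-centres-determine Y Z gY gZ a c lt cN ya yc za zc
  ... | tri≈ _ eq _ = ⊥-elim (ne eq)
  ... | tri> _ _ gt = two-centres-determine Y Z gY gZ c a gt aN yc ya zc za

  BAdj⇒right-slide : ∀ X Y → Optimal X → Optimal Y → ∀ a b c → IsPairℕ (centre₁ X) (centre₂ X) a b → IsPairℕ (centre₁ Y)
      (centre₂ Y) a c → (b + 3) % suc (3 * k) ≡ c →
             Slide X Y (fin (2 + (b + N-1))) (fin (3 + (b + N-1)))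
  BAdj⇒right-slide X Y gX gY a b c pX pY sh = V.exy , V.xX , V.yX' , centres-determine Y V.Z gY gZ a c aN cN anc ya yc za zc
    where
    reindex : ∀ b n → suc (suc (suc (suc (b + suc (suc (suc n)))))) ≡ (b + 3) + suc (suc (suc (suc n)))
    reindex = solve-∀
    open DistinctCentres (pair-centres X gX a b pX)
      renaming (a<N to aN; b<N to bN; a≢b to anb; centre-a to xa; centre-b to xb)
    open DistinctCentres (pair-centres Y gY a c pY)
      renaming (b<N to cN; a≢b to anc; centre-a to ya; centre-b to yc) hiding (a<N)
    sh' : (b + 3) % N ≡ c
    sh' = trans (sym (%1+3k≡%N (b + 3))) sh
    u = b + N-1
    b4 : χ X (4 + u) ≡ false
    b4 = ≢true⇒false λ e4 → go (trans (sym (χ-suc+N-1 X (3 + b))) e4)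
      where
      go : χ X (3 + b) ≡ true → ⊥
      go e3 with (2 + b) % N ≟ a % N
      ... | no ne = no-three-centres X gX (2 + b) a b ne (λ q → +-mod-≢ b 2 (s≤s z≤n) (s≤s (s≤s (s≤s z≤n))) (trans (cong (_% N)
          (+-comm b 2)) q)) (λ q → anb (trans (sym (<N⇒%≡ aN)) (trans q (<N⇒%≡ bN)))) c2 xa xb
        where
        c2 : Centre X (2 + b)
        c2 = trans (χ-suc+N-1 X (suc b)) (proj₂ xb) , e3
      ... | yes q = centres-not-adjacent Y (opt-ind gY) a c ya yc (trans (sym (mod-suc a)) (trans (cong (λ z → suc z % N) (sym q))
          (trans (mod-suc (2 + b)) (trans (cong (_% N) (+-comm 3 b)) (trans sh' (sym (<N⇒%≡ cN)))))))
    module V = SlideRight X (opt-ind gX) (opt-dom gX) u (proj₁ xb) (trans (χ-suc+N-1 X (suc b)) (proj₂ xb)) b4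
    gZ : Optimal V.Z
    gZ = optimal V.IndZ V.DomZ (trans V.cardZ (opt-size gX))
    zc : Centre V.Z c
    zc = Centre-cong V.Z {4 + u} {c} (trans (cong (_% N) (reindex b n'')) (trans ([m+n]%n≡m%n (b + 3) N) (trans sh' (sym
        (<N⇒%≡ cN))))) V.cenZ
    za : Centre V.Z a
    za = V.persist a xa (λ q → anb (trans (sym (<N⇒%≡ aN)) (trans q (trans (cong (_% N) (sym (+-suc b N-1))) (trans
        ([m+n]%n≡m%n b N) (<N⇒%≡ bN))))))

  BAdj⇒left-slide : ∀ X Y → Optimal X → Optimal Y → ∀ a b c → IsPairℕ (centre₁ X) (centre₂ X) a b → IsPairℕ (centre₁ Y)
      (centre₂ Y) a c → (c + 3) % suc (3 * k) ≡ b →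
              Slide X Y (fin (3 + (b + n''))) (fin (2 + (b + n'')))
  BAdj⇒left-slide X Y gX gY a b c pX pY sh = V.exy , V.xX , V.yX' , centres-determine Y V.Z gY gZ a c aN cN anc ya yc za zc
    where
    reindex₄ : ∀ b n → suc (suc (suc (suc (b + n)))) ≡ b + suc (suc (suc (suc n)))
    reindex₄ = solve-∀
    reindex₃ : ∀ b n → suc (suc (suc (b + n))) ≡ b + suc (suc (suc n))
    reindex₃ = solve-∀
    open DistinctCentres (pair-centres X gX a b pX)
      renaming (a<N to aN; b<N to bN; a≢b to anb; centre-a to xa; centre-b to xb)
    open DistinctCentres (pair-centres Y gY a c pY)
      renaming (b<N to cN; a≢b to anc; centre-a to ya; centre-b to yc) hiding (a<N)
    u = b + n''
    e4 : (4 + u) % N ≡ b % N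
    e4 = trans (cong (_% N) (reindex₄ b n'')) ([m+n]%n≡m%n b N)
    sh' : (3 + c) % N ≡ (3 + (1 + u)) % N
    sh' = trans (cong (_% N) (+-comm 3 c)) (trans (sym (%1+3k≡%N (c + 3))) (trans sh (trans (sym (<N⇒%≡ bN)) (sym e4))))
    cu : c % N ≡ (1 + u) % N
    cu = 3+-mod-injective c (1 + u) sh'
    b3 : χ X (3 + u) ≡ true
    b3 = trans (cong (χ X) (reindex₃ b n'')) (proj₁ xb)
    b5 : χ X (5 + u) ≡ true
    b5 = trans (cong (χ X) (cong suc (reindex₄ b n''))) (trans (χ-periodic X (suc b)) (proj₂ xb))
    b1 : χ X (1 + u) ≡ false
    b1 = ≢true⇒false λ e1 → go e1
      where
      go : χ X (1 + u) ≡ true → ⊥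
      go e1 with (2 + u) % N ≟ a % N
      ... | no ne = no-three-centres X gX (2 + u) a b ne nb (λ q → anb (trans (sym (<N⇒%≡ aN)) (trans q (<N⇒%≡ bN)))) c2 xa xb
        where
        c2 : Centre X (2 + u)
        c2 = trans (χ-suc+N-1 X (1 + u)) e1 , b3
        nb : (2 + u) % N ≢ b % N
        nb q = +-mod-≢ (2 + u) 2 (s≤s z≤n) (s≤s (s≤s (s≤s z≤n))) (trans (cong (_% N) (+-comm (2 + u) 2)) (trans e4 (sym q)))
      ... | yes q = centres-not-adjacent Y (opt-ind gY) c a yc ya (trans (sym (mod-suc c)) (trans (cong (λ z → suc z % N) cu)
          (trans (mod-suc (1 + u)) q)))
    module V = SlideLeft X (opt-ind gX) (opt-dom gX) u b3 b5 b1
    gZ : Optimal V.Z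
    gZ = optimal V.IndZ V.DomZ (trans V.cardZ (opt-size gX))
    zc : Centre V.Z c
    zc = Centre-cong V.Z {1 + u} {c} (sym cu) V.cenZ
    za : Centre V.Z a
    za = V.persist a xa (λ q → anb (trans (sym (<N⇒%≡ aN)) (trans q (trans e4 (<N⇒%≡ bN)))))

  IAdj⇒BAdj : ∀ X Y → IAdj G X Y → BAdj k (to X) (to Y)
  IAdj⇒BAdj (iset s p) (iset s' p') (x , y , e , xm , ym , eqY) with suc (toℕ x) % N ≟ toℕ y
  ... | yes d = other-centre s ((toℕ x + N-1) % N) , (toℕ x + N-1) % N , (toℕ x + 2) % N ,
                recompute (BAdjℕ? _ _ _ _ _ _ _) (right-slide⇒BAdj s s' (isISet⇒optimal s p)
                    (isISet⇒optimal s' p') x y e xm ym eqY d)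
  ... | no nd with CycleE⇒ e
  ...   | inj₁ q = ⊥-elim (nd q)
  ...   | inj₂ d = other-centre s ((toℕ x + 1) % N) , (toℕ x + 1) % N , (toℕ x + suc (suc n'')) % N ,
                recompute (BAdjℕ? _ _ _ _ _ _ _) (left-slide⇒BAdj s s' (isISet⇒optimal s p)
                    (isISet⇒optimal s' p') x y e xm ym eqY d)

  BAdj⇒IAdj : ∀ X Y → BAdj k (to X) (to Y) → IAdj G X Y
  BAdj⇒IAdj (iset s p) (iset s' p') (a , b , c , pX , pY , inj₁ sh) =
    fin (2 + (b + N-1)) , fin (3 + (b + N-1)) , recompute (Slide? _ _ _ _) (BAdj⇒right-slide s s' (isISet⇒optimal s p)
        (isISet⇒optimal s' p') a b c pX pY sh)
  BAdj⇒IAdj (iset s p) (iset s' p') (a , b , c , pX , pY , inj₂ sh) =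
    fin (3 + (b + n'')) , fin (2 + (b + n'')) , recompute (Slide? _ _ _ _) (BAdj⇒left-slide s s' (isISet⇒optimal s p)
        (isISet⇒optimal s' p') a b c pX pY sh)

  iso : iGraph G ≅ Bracelet k
  iso = record
    { to = to ; from = from ; from∘to = from∘to ; to∘from = to∘from
    ; adj-to = IAdj⇒BAdj ; adj-from = BAdj⇒IAdj }

module Cycle3k+2 (n'' t : ℕ) (hN : suc (suc (suc (suc n''))) ≡ thrice t + 2) where

  open OnCycle (suc n'')
  open Slides n''

  [M+1]*c≡c+c*M : ∀ M c → (M + 1) * c ≡ c + c * M
  [M+1]*c≡c+c*M M c = trans (*-distribʳ-+ c M 1) (trans (+-comm (M * c) (1 * c)) (cong₂ _+_ (*-identityˡ c) (*-comm M c)))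

  N-1≡3t+1 : N-1 ≡ thrice t + 1
  N-1≡3t+1 = suc-injective (trans hN (+-suc (thrice t) 1))

  every3rd-pattern : Pattern every3rd
  every3rd-pattern = record { starts-in = refl ; ends-out = trans (cong every3rd N-1≡3t+1)
      (every3rd-thrice+ t 1) ; independent = λ o _ → every3rd-independent o ; dominating = λ o _ → every3rd-dominating o }

  optimal-every3rd : ∀ a → Optimal (place a every3rd)
  optimal-every3rd a = Optimal-place every3rd-pattern a (Σ-every3rd N)

  3⌈N/3⌉≡N+1 : 3 * ⌈/3⌉ N ≡ N + 1
  3⌈N/3⌉≡N+1 = trans (cong (λ m → 3 * ⌈/3⌉ m) hN) (trans (cong (3 *_) (trans (⌈/3⌉-thrice+ t 2) (+-comm t 1))) (trans (sym
      (thrice≡3* (suc t))) (trans (trans (+-comm 3 (thrice t)) (sym (+-assoc (thrice t) 2 1))) (cong (_+ 1) (sym hN)))))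

  Σ-weight≡N+1 : ∀ X → Optimal X → Σ< N (weight X) ≡ N + 1
  Σ-weight≡N+1 X g = trans (Σ-weight-optimal X g) 3⌈N/3⌉≡N+1

  centre-unique : ∀ X → Optimal X → ∀ c1 c2 → Centre X c1 → Centre X c2 → c1 % N ≡ c2 % N
  centre-unique X g c1 c2 h1 h2 with c1 % N ≟ c2 % N
  ... | yes e = e
  ... | no ne = ⊥-elim (m+1+n≰m+n N 1 (≤-trans (Σ-excess₂ N (weight X) (window c1) (window c2) (window<N c1) (window<N c2)
      (λ e → ne (+N-1-mod-injective {c1} {c2} e)) (λ v _ → weight≥1 X (opt-dom g) v)
                   (≤-reflexive (sym (weight-window X (opt-ind g) c1 h1))) (≤-reflexive (sym (weight-window X
                       (opt-ind g) c2 h2)))) (≤-reflexive (Σ-weight≡N+1 X g))))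

  opaque
    centre : Subset N → ℕ
    centre X = first (centre? X) 0 N

  opaque
    unfolding centre

    centre-spec : ∀ X → Optimal X → centre X < N × Centre X (centre X)
    centre-spec X g with search< (λ v → centre? X (suc v)) N
    ... | inj₁ (j , p , q) with first-spec (centre? X) N 0 ((suc j) % N) z≤n (m%n<n (suc j) N) (Centre⇒centre? X _ (Centre-mod X
        (suc j) (centre?⇒Centre X (suc j) q)))
    ...   | _ , le , pc = ≤-<-trans le (m%n<n (suc j) N) , centre?⇒Centre X _ pc
    centre-spec X g | inj₂ h = ⊥-elim (m+1+n≰m+n N 0 (≤-trans (≤-reflexive (sym (Σ-weight≡N+1 X g))) (≤-trans (Σ-≤1 N
        (weight X) le1) (≤-reflexive (sym (+-identityʳ N))))))
      where
      le1 : ∀ v → v < N → weight X v ≤ 1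
      le1 v p with weight1⊎centre X (opt-ind g) (opt-dom g) v
      ... | inj₁ e = ≤-reflexive e
      ... | inj₂ c = ⊥-elim (true≢false (trans (sym (Centre⇒centre? X (suc v) c)) (h v p)))

  χ-after-centre : ∀ X → Optimal X → ∀ c → Centre X c → ∀ o → o < N → χ X (suc c + o) ≡ every3rd o
  χ-after-centre X g c ce = χ-from-centre X g c (suc (suc n'')) ce none
    where
    none : ∀ o → o < suc (suc n'') → ¬ Centre X (suc (suc c + o))
    none o p c' = +-mod-≢ c (suc (suc o)) (s≤s z≤n) (s≤s (s≤s p))
      (trans (cong (_% N) (trans (+-suc c (suc o)) (cong suc (+-suc c o)))) (centre-unique X g _ c c' ce))

  ≡place-centre : ∀ X → Optimal X → ∀ c → Centre X c → X ≡ place (suc c) every3rd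
  ≡place-centre X g c ce = place-unique X (suc c) every3rd (χ-after-centre X g c ce)

  centre-place : ∀ c → Centre (place (suc c) every3rd) c
  centre-place c = trans (cong (χ (place (suc c) every3rd)) (+-suc c (suc (suc n'')))) (trans (χ-place-from (suc c) every3rd (suc
      (suc n''))) (trans (cong every3rd (m<n⇒m%n≡m (s≤s (s≤s (s≤s (n≤1+n n'')))))) pM2)) ,
               trans (cong (χ (place (suc c) every3rd)) (sym (+-identityʳ (suc c)))) (χ-place-from (suc c) every3rd 0)
    where
    pM2 : every3rd (suc (suc n'')) ≡ true
    pM2 = trans (cong every3rd (suc-injective (trans N-1≡3t+1 (+-suc (thrice t) 0)))) (every3rd-thrice+ t 0)

  3⁻¹ : ℕ
  3⁻¹ = suc t

  3*3⁻¹≡N+1 : 3 * 3⁻¹ ≡ N + 1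
  3*3⁻¹≡N+1 = trans (sym (thrice≡3* (suc t))) (trans (+-comm 3 (thrice t)) (trans (sym (+-assoc (thrice t) 2 1)) (cong (_+ 1)
      (sym hN))))

  mod-* : ∀ a m → (a * (m % N)) % N ≡ (a * m) % N
  mod-* a m = trans (%-distribˡ-* a (m % N) N) (trans (cong (λ z → ((a % N) * z) % N) (mod-idem m)) (sym (%-distribˡ-* a m N)))

  [N+1]*-mod : ∀ c → ((N + 1) * c) % N ≡ c % N
  [N+1]*-mod c = trans (cong (_% N) ([M+1]*c≡c+c*M N c)) ([m+kn]%n≡m%n c c N)

  3*3⁻¹*-mod : ∀ c → (3 * ((3⁻¹ * c) % N)) % N ≡ c % N
  3*3⁻¹*-mod c = trans (mod-* 3 (3⁻¹ * c)) (trans (cong (_% N) (sym (*-assoc 3 3⁻¹ c))) (trans (cong (λ z →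
      (z * c) % N) 3*3⁻¹≡N+1) ([N+1]*-mod c)))

  3⁻¹*3*-mod : ∀ v → v < N → (3⁻¹ * ((3 * v) % N)) % N ≡ v
  3⁻¹*3*-mod v p = trans (mod-* 3⁻¹ (3 * v)) (trans (cong (_% N) (sym (*-assoc 3⁻¹ 3 v))) (trans (cong (λ z → (z * v) % N) (trans
      (*-comm 3⁻¹ 3) 3*3⁻¹≡N+1)) (trans ([N+1]*-mod v) (m<n⇒m%n≡m p))))

  3⁻¹-shift : ∀ c c' → c' % N ≡ (c + 3) % N → (3⁻¹ * c') % N ≡ suc ((3⁻¹ * c) % N) % N
  3⁻¹-shift c c' e = begin
      (3⁻¹ * c') % N
    ≡⟨ sym (mod-* 3⁻¹ c') ⟩
      (3⁻¹ * (c' % N)) % N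
    ≡⟨ cong (λ z → (3⁻¹ * z) % N) e ⟩
      (3⁻¹ * ((c + 3) % N)) % N
    ≡⟨ mod-* 3⁻¹ (c + 3) ⟩
      (3⁻¹ * (c + 3)) % N
    ≡⟨ cong (_% N) (trans (*-distribˡ-+ 3⁻¹ c 3) (cong (3⁻¹ * c +_) (trans (*-comm 3⁻¹ 3) 3*3⁻¹≡N+1))) ⟩
      (3⁻¹ * c + (N + 1)) % N
    ≡⟨ cong (_% N) (trans (cong (3⁻¹ * c +_) (+-comm N 1)) (sym (+-assoc (3⁻¹ * c) 1 N))) ⟩
      (3⁻¹ * c + 1 + N) % N
    ≡⟨ [m+n]%n≡m%n (3⁻¹ * c + 1) N ⟩
      (3⁻¹ * c + 1) % N
    ≡⟨ cong (_% N) (+-comm (3⁻¹ * c) 1) ⟩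
      suc (3⁻¹ * c) % N
    ≡⟨ sym (mod-suc (3⁻¹ * c)) ⟩
      suc ((3⁻¹ * c) % N) % N ∎
    where open ≡-Reasoning

  3⁻¹-unshift : ∀ c c' → suc ((3⁻¹ * c) % N) % N ≡ (3⁻¹ * c') % N → c' % N ≡ (3 + c) % N
  3⁻¹-unshift c c' e = begin
      c' % N
    ≡⟨ sym (3*3⁻¹*-mod c') ⟩
      (3 * ((3⁻¹ * c') % N)) % N
    ≡⟨ cong (λ z → (3 * z) % N) (sym e) ⟩
      (3 * (suc ((3⁻¹ * c) % N) % N)) % N
    ≡⟨ mod-* 3 (suc ((3⁻¹ * c) % N)) ⟩
      (3 * suc ((3⁻¹ * c) % N)) % N
    ≡⟨ cong (_% N) (*-suc 3 ((3⁻¹ * c) % N)) ⟩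
      (3 + 3 * ((3⁻¹ * c) % N)) % N
    ≡⟨ sym (mod-+ˡ 3 (3 * ((3⁻¹ * c) % N))) ⟩
      (3 + (3 * ((3⁻¹ * c) % N)) % N) % N
    ≡⟨ cong (λ z → (3 + z) % N) (3*3⁻¹*-mod c) ⟩
      (3 + c % N) % N
    ≡⟨ mod-+ˡ 3 c ⟩
      (3 + c) % N ∎
    where open ≡-Reasoning

  every3rd-at-N-4 : every3rd n'' ≡ false
  every3rd-at-N-4 = every3rd-at-3t-2 n'' t hN

  isISet⇒optimal : ∀ X → IsISet G X → Optimal X
  isISet⇒optimal X p = IsISet⇒Optimal (place 0 every3rd) (optimal-every3rd 0) X p

  to : ISet G → Fin N
  to X = fin (3⁻¹ * centre (ISet.set X))

  from : Fin N → ISet G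
  from v = iset (place (suc ((3 * toℕ v) % N)) every3rd) (Optimal⇒IsISet _ (optimal-every3rd _))

  place-to : ∀ X → Optimal X → place (suc ((3 * toℕ (fin (3⁻¹ * centre X))) % N)) every3rd ≡ X
  place-to X g = trans (place-cong every3rd e) (sym (≡place-centre X g (centre X) (proj₂ (centre-spec X g))))
    where
    e1 : (3 * toℕ (fin (3⁻¹ * centre X))) % N ≡ centre X % N
    e1 = trans (cong (λ z → (3 * z) % N) (toℕ-fin (3⁻¹ * centre X))) (3*3⁻¹*-mod (centre X))
    e : suc ((3 * toℕ (fin (3⁻¹ * centre X))) % N) % N ≡ suc (centre X) % N
    e = trans (sym (mod-suc ((3 * toℕ (fin (3⁻¹ * centre X))) % N))) (trans (cong (λ z → suc z % N) (trans (mod-idem (3 * toℕ (fin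
        (3⁻¹ * centre X)))) e1)) (mod-suc (centre X)))

  from∘to : ∀ X → from (to X) ≡ X
  from∘to (iset s p) = iset-ext (recompute (≡? _ _) (place-to s (isISet⇒optimal s p)))

  to∘from : ∀ v → to (from v) ≡ v
  to∘from v = toℕ-injective (trans (toℕ-fin (3⁻¹ * centre Xv)) (trans (cong (λ z → (3⁻¹ * z) % N) ceq) (3⁻¹*3*-mod (toℕ v)
      (toℕ<n v))))
    where
    c = (3 * toℕ v) % N
    Xv = place (suc c) every3rd
    ceq : centre Xv ≡ c
    ceq = trans (sym (m<n⇒m%n≡m (proj₁ (centre-spec Xv (optimal-every3rd _))))) (trans (centre-unique Xv (optimal-every3rd _)
        (centre Xv) c (proj₂ (centre-spec Xv (optimal-every3rd _))) (centre-place c)) (mod-idem (3 * toℕ v)))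

  centre-mod-unique : ∀ X → Optimal X → ∀ c → Centre X c → centre X % N ≡ c % N
  centre-mod-unique X g c ce = centre-unique X g (centre X) c (proj₂ (centre-spec X g)) ce

  slide⇒CycleE : ∀ X Y → Optimal X → Optimal Y → (x y : Fin N) → CycleE N x y → x ∈ X → y ∉ X → Y ≡ (X - x) ∪ ⁅ y ⁆ →
               CycleE N (fin (3⁻¹ * centre X)) (fin (3⁻¹ * centre Y))
  slide⇒CycleE X Y gX gY x y e xm ym eqY = go (CentreShift.shift r)
    where
    r = SlideCentres.slide X Y x y eqY (opt-ind gX) (opt-dom gX) (opt-ind gY) (opt-dom gY) (∈⇒χ xm) (∉⇒χ ym) e
    cX = CentreShift.cX r
    cY = CentreShift.cY r
    eX : centre X % N ≡ cX % N
    eX = centre-mod-unique X gX cX (CentreShift.cenX r)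
    eY : centre Y % N ≡ cY % N
    eY = centre-mod-unique Y gY cY (CentreShift.cenY r)
    go : (cX + 3) % N ≡ cY % N ⊎ (cY + 3) % N ≡ cX % N → CycleE N (fin (3⁻¹ * centre X)) (fin (3⁻¹ * centre Y))
    go (inj₁ s) = CycleE-suc (trans (cong (λ z → suc z % N) (toℕ-fin (3⁻¹ * centre X))) (trans (sym (3⁻¹-shift (centre X)
        (centre Y) (trans eY (trans (sym s) (+-mod-cong {cX} {centre X} 3 (sym eX)))))) (sym (toℕ-fin (3⁻¹ * centre Y)))))
    go (inj₂ s) = CycleE-sym (CycleE-suc (trans (cong (λ z → suc z % N) (toℕ-fin (3⁻¹ * centre Y))) (trans (sym (3⁻¹-shift
        (centre Y) (centre X) (trans eX (trans (sym s) (+-mod-cong {cY} {centre Y} 3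
        (sym eY)))))) (sym (toℕ-fin (3⁻¹ * centre X))))))

  slide-right : ∀ X Y → Optimal X → Optimal Y → suc ((3⁻¹ * centre X) % N) % N ≡ (3⁻¹ * centre Y) % N →
          Slide X Y (fin (2 + (centre X + N-1))) (fin (3 + (centre X + N-1)))
  slide-right X Y gX gY d = V.exy , V.xX , V.yX' , trans (≡place-centre Y gY (centre Y) cY) (trans (place-cong every3rd ceq) (sym
      (≡place-centre V.Z gZ (4 + u) V.cenZ)))
    where
    c = centre X
    cX = proj₂ (centre-spec X gX)
    cY = proj₂ (centre-spec Y gY)
    u = c + N-1
    b4 : χ X (4 + u) ≡ false
    b4 = trans (χ-suc+N-1 X (3 + c)) (trans (cong (χ X) (cong suc (+-comm 2 c))) (χ-after-centre X gX c cX 2 (s≤s (s≤s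
        (s≤s z≤n)))))
    module V = SlideRight X (opt-ind gX) (opt-dom gX) u (proj₁ cX) (trans (χ-suc+N-1 X (suc c)) (proj₂ cX)) b4
    gZ : Optimal V.Z
    gZ = optimal V.IndZ V.DomZ (trans V.cardZ (opt-size gX))
    e4 : (4 + u) % N ≡ (3 + c) % N
    e4 = trans (cong (_% N) (trans (cong (λ z → suc (suc (suc z))) (trans (cong suc (+-comm c N-1)) (+-comm
        (suc N-1) c))) refl)) ([m+n]%n≡m%n (3 + c) N)
    ceq : suc (centre Y) % N ≡ suc (4 + u) % N
    ceq = trans (sym (mod-suc (centre Y))) (trans (cong (λ z → suc z % N) (trans (3⁻¹-unshift c (centre Y) d) (sym e4))) (mod-suc
        (4 + u)))

  slide-left : ∀ X Y → Optimal X → Optimal Y → suc ((3⁻¹ * centre Y) % N) % N ≡ (3⁻¹ * centre X) % N →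
           Slide X Y (fin (3 + (centre X + n''))) (fin (2 + (centre X + n'')))
  slide-left X Y gX gY d = V.exy , V.xX , V.yX' , trans (≡place-centre Y gY (centre Y) cY) (trans (place-cong every3rd ceq) (sym
      (≡place-centre V.Z gZ (1 + u) V.cenZ)))
    where
    c = centre X
    cX = proj₂ (centre-spec X gX)
    cY = proj₂ (centre-spec Y gY)
    u = c + n''
    e3 : 3 + u ≡ c + N-1
    e3 = sym (trans (+-suc c (suc (suc n''))) (cong suc (trans (+-suc c (suc n'')) (cong suc (+-suc c n'')))))
    e4 : 4 + u ≡ c + N
    e4 = trans (cong suc e3) (sym (+-suc c N-1))
    b3 : χ X (3 + u) ≡ true
    b3 = trans (cong (χ X) e3) (proj₁ cX)
    b5 : χ X (5 + u) ≡ true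
    b5 = trans (cong (χ X) (trans (cong suc e4) refl)) (trans (χ-periodic X (suc c)) (proj₂ cX))
    b1 : χ X (1 + u) ≡ false
    b1 = trans (χ-after-centre X gX c cX n'' (≤-trans (n≤1+n (suc n'')) (≤-trans (n≤1+n (suc (suc n''))) (n≤1+n (suc (suc
        (suc n''))))))) every3rd-at-N-4
    module V = SlideLeft X (opt-ind gX) (opt-dom gX) u b3 b5 b1
    gZ : Optimal V.Z
    gZ = optimal V.IndZ V.DomZ (trans V.cardZ (opt-size gX))
    e4' : (3 + (1 + u)) % N ≡ c % N
    e4' = trans (cong (_% N) e4) ([m+n]%n≡m%n c N)
    cy : centre Y % N ≡ (1 + u) % N
    cy = 3+-mod-injective (centre Y) (1 + u) (trans (sym (3⁻¹-unshift (centre Y) c d)) (sym e4'))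
    ceq : suc (centre Y) % N ≡ suc (1 + u) % N
    ceq = trans (sym (mod-suc (centre Y))) (trans (cong (λ z → suc z % N) cy) (mod-suc (1 + u)))

  suc-fin-mod : ∀ a b → suc (toℕ (fin a)) % N ≡ toℕ (fin b) → suc (a % N) % N ≡ b % N
  suc-fin-mod a b e = trans (cong (λ z → suc z % N) (sym (toℕ-fin a))) (trans e (toℕ-fin b))

  adjTo : ∀ X Y → IAdj G X Y → CycleE N (to X) (to Y)
  adjTo (iset s p) (iset s' p') (x , y , e , xm , ym , eqY) = recompute (CycleE? _ _) (slide⇒CycleE s s' (isISet⇒optimal s p)
      (isISet⇒optimal s' p') x y e xm ym eqY)

  adjFrom : ∀ X Y → CycleE N (to X) (to Y) → IAdj G X Y
  adjFrom (iset s p) (iset s' p') e with suc (toℕ (to (iset s p))) % N ≟ toℕ (to (iset s' p'))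
  ... | yes d = fin (2 + (centre s + N-1)) , fin (3 + (centre s + N-1)) ,
                recompute (Slide? s s' _ _) (slide-right s s' (isISet⇒optimal s p) (isISet⇒optimal s' p') (suc-fin-mod
                    (3⁻¹ * centre s) (3⁻¹ * centre s') d))
  ... | no nd with CycleE⇒ e
  ...   | inj₁ q = ⊥-elim (nd q)
  ...   | inj₂ q = fin (3 + (centre s + n'')) , fin (2 + (centre s + n'')) ,
                recompute (Slide? s s' _ _) (slide-left s s' (isISet⇒optimal s p) (isISet⇒optimal s' p') (suc-fin-mod
                    (3⁻¹ * centre s') (3⁻¹ * centre s) q))

  iso : iGraph G ≅ asGraph G
  iso = record
    { to = to ; from = from ; from∘to = from∘to ; to∘from = to∘from
    ; adj-to = adjTo ; adj-from = adjFrom }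

[3k+1]%3≡1 : ∀ k → (3 * k + 1) % 3 ≡ 1
[3k+1]%3≡1 k = trans (cong (_% 3) (trans (+-comm (3 * k) 1) (cong (1 +_) (*-comm 3 k)))) ([m+kn]%n≡m%n 1 k 3)

m%3≡2⇒m≡thrice+2 : ∀ m → m % 3 ≡ 2 → m ≡ thrice (m / 3) + 2
m%3≡2⇒m≡thrice+2 m e = begin
  m                   ≡⟨ m≡m%n+[m/n]*n m 3 ⟩
  m % 3 + m / 3 * 3   ≡⟨ cong (_+ m / 3 * 3) e ⟩
  2 + m / 3 * 3       ≡⟨ +-comm 2 (m / 3 * 3) ⟩
  m / 3 * 3 + 2       ≡⟨ cong (_+ 2) (trans (*-comm (m / 3) 3) (sym (thrice≡3* (m / 3)))) ⟩
  thrice (m / 3) + 2  ∎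
  where open ≡-Reasoning

iGraph-C3k≥6 : ∀ n' k → 3 + n' ≡ 3 * k → 6 ≤ 3 + n' → iGraph (Cycle (3 + n')) ≅ threeK1
iGraph-C3k≥6 (suc (suc (suc m))) k e _ = Cycle3k≥6.iso m k (trans e (sym (thrice≡3* k)))
iGraph-C3k≥6 zero k e (s≤s (s≤s (s≤s ())))
iGraph-C3k≥6 (suc zero) k e (s≤s (s≤s (s≤s (s≤s ()))))
iGraph-C3k≥6 (suc (suc zero)) k e (s≤s (s≤s (s≤s (s≤s (s≤s ())))))

iGraph-C3k+1 : ∀ n' k → 3 + n' ≡ 3 * k + 1 → iGraph (Cycle (3 + n')) ≅ Bracelet k
iGraph-C3k+1 zero k e with trans (cong (_% 3) e) ([3k+1]%3≡1 k)
... | ()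
iGraph-C3k+1 (suc n'') k e = Cycle3k+1.iso n'' k (trans e (cong (_+ 1) (sym (thrice≡3* k))))

iGraph-C3k+2 : ∀ n' → (3 + n') % 3 ≡ 2 → iGraph (Cycle (3 + n')) ≅ asGraph (Cycle (3 + n'))
iGraph-C3k+2 zero ()
iGraph-C3k+2 (suc n'') e = Cycle3k+2.iso n'' _ (m%3≡2⇒m≡thrice+2 (4 + n'') e)

mainTheorem2 : (n k : ℕ) → 3 ≤ n →
    (n ≡ 3 → iGraph (Cycle n) ≅ K3)
    × (n ≡ 3 * k → 6 ≤ n → iGraph (Cycle n) ≅ threeK1)
    × (n ≡ 3 * k + 1 → iGraph (Cycle n) ≅ Bracelet k)
    × (n % 3 ≡ 2 → iGraph (Cycle n) ≅ asGraph (Cycle n))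
mainTheorem2 (suc (suc (suc n'))) k (s≤s (s≤s (s≤s _))) =
  (λ { refl → Cycle3.iso }) , iGraph-C3k≥6 n' k , iGraph-C3k+1 n' k , iGraph-C3k+2 n'
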